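{- For $m\geq 2$ and $n\geq 0$, $$X_{L_{m,n}}=(m-1)!\left(X_{P_{n+m}}-\sum_{i=1}^{m-2}\frac{m-i-1}{(m-i)!}X_{K_{m-i}}X_{P_{n+i}}\right).$$
   Context: All graphs are finite and simple. For a graph $G$ with vertex set $\{v_1,\dots,v_N\}$, the chromatic symmetric function is $X_G=\sum_\kappa x_{\kappa(v_1)}\cdots x_{\kappa(v_N)}$, summed over all proper colourings $\kappa:V\to\{1,2,\dots\}$; $X_\emptyset=1$. $K_m$ is the complete graph on $m$ vertices, $P_n$ the path on $n$ vertices. For $m,n\geq1$ the lollipop graph $L_{m,n}$ is obtained from the disjoint union of $K_m$ and $P_n$ by adding an edge joining a vertex of $K_m$ to an end vertex of $P_n$; conventions $K_0=P_0=L_{0,0}=\emptyset$, $L_{m,0}=K_m$, $L_{0,n}=P_n$. -}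

module Defs where

open import Data.Bool using (Bool; true; false; _∧_; _∨_; not)
open import Data.Nat using (ℕ; zero; suc; _∸_; _<ᵇ_; _≤ᵇ_; _≡ᵇ_; _!)
open import Data.Fin using (Fin; toℕ)
open import Data.Fin.Properties using () renaming (_≟_ to _≟F_)
open import Data.List using (List; []; _∷_; map; concatMap; filterᵇ; length; allFin; foldr; zipWith; upTo)
open import Data.Bool.ListAction using (and)
open import Data.Vec using (Vec; []; _∷_; lookup)
open import Data.Integer using (+_)
open import Data.Rational using (ℚ; _/_; 0ℚ) renaming (_+_ to _+ℚ_; _-_ to _-ℚ_; _*_ to _*ℚ_)
import Data.Nat.Properties
open import Relation.Nullary.Decidable using (⌊_⌋)

-- Finite simple graphs on the vertex set Fin N, given by a (symmetric,
-- irreflexive) boolean adjacency relation.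

record Graph : Set where
  field
    N   : ℕ
    adj : Fin N → Fin N → Bool
open Graph public

-- Lollipop graph L_{m,n} on vertices 0,…,m+n-1:
-- vertices 0,…,m-1 form K_m; vertices m-1, m, …, m+n-1 are joined
-- consecutively, i.e. {m-1,m} is the edge from K_m to the end vertex m
-- of the path m,…,m+n-1.  For m = 0 this is just the path P_n, for
-- n = 0 just K_m, and L_{0,0} is the empty graph (matching the
-- conventions of the paper).

lolliAdj : ℕ → ℕ → ℕ → Bool
lolliAdj m u v =
  ((u <ᵇ m) ∧ (v <ᵇ m) ∧ not (u ≡ᵇ v))
  ∨ (((m ∸ 1) ≤ᵇ u) ∧ (v ≡ᵇ suc u))
  ∨ (((m ∸ 1) ≤ᵇ v) ∧ (u ≡ᵇ suc v))

Lollipop : ℕ → ℕ → Graph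
Lollipop m n = record { N = m Data.Nat.+ n ; adj = λ u v → lolliAdj m (toℕ u) (toℕ v) }

K : ℕ → Graph
K m = Lollipop m 0

P : ℕ → Graph
P n = Lollipop 0 n

-- Formal power series in the variables x_1, x_2, … with rational
-- coefficients, represented by their coefficient function: a monomial
-- x_1^{a_1} ⋯ x_k^{a_k} is given by its exponent list a = (a_1,…,a_k)
-- (trailing zeros are irrelevant for all series built below).

PowerSeries : Set
PowerSeries = List ℕ → ℚ

maps : (k N : ℕ) → List (Vec (Fin k) N)
maps k zero    = [] ∷ []
maps k (suc N) = concatMap (λ c → map (c ∷_) (maps k N)) (allFin k)

proper : (G : Graph) {k : ℕ} → Vec (Fin k) (N G) → Bool
proper G κ = and (concatMap (λ u → map (λ v → not (adj G u v) ∨ not ⌊ lookup κ u ≟F lookup κ v ⌋) (allFin (N G))) (allFin (N G)))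

classSize : {k N : ℕ} → Vec (Fin k) N → Fin k → ℕ
classSize {N = N} κ c = length (filterᵇ (λ v → ⌊ lookup κ v ≟F c ⌋) (allFin N))

hasType : {N : ℕ} (a : List ℕ) → Vec (Fin (length a)) N → Bool
hasType a κ = and (map (λ c → classSize κ c ≡ᵇ Data.List.lookup a c) (allFin (length a)))

X : Graph → PowerSeries
X G a = + length (filterᵇ (λ κ → proper G κ ∧ hasType a κ) (maps (length a) (N G))) / 1

infixl 6 _⊕_ _⊖_
infixl 7 _⊛_ _·_

_⊕_ : PowerSeries → PowerSeries → PowerSeries
(F ⊕ G) a = F a +ℚ G a

_⊖_ : PowerSeries → PowerSeries → PowerSeries
(F ⊖ G) a = F a -ℚ G a

_·_ : ℚ → PowerSeries → PowerSeries
(q · F) a = q *ℚ F a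

below : List ℕ → List (List ℕ)
below []      = [] ∷ []
below (x ∷ a) = concatMap (λ i → map (i ∷_) (below a)) (upTo (suc x))

_⊛_ : PowerSeries → PowerSeries → PowerSeries
(F ⊛ G) a = foldr _+ℚ_ 0ℚ (map (λ b → F b *ℚ G (zipWith _∸_ a b)) (below a))

zeroPS : PowerSeries
zeroPS _ = 0ℚ

Σ[1…_]_ : ℕ → (ℕ → PowerSeries) → PowerSeries
Σ[1… r ] f = foldr (λ i S → f (suc i) ⊕ S) zeroPS (upTo r)

_over_! : ℕ → ℕ → ℚ
p over q ! = (+ p / (q !)) {{Data.Nat.Properties._!≢0 q}}

fact : ℕ → ℚ
fact q = + (q !) / 1

-- Coefficientwise, X_G counts the proper colourings of G of a given type, and the X of a disjoint
-- union is the product of the X's.  Sort the proper colourings of K_m ⊔ P_{n+1} (m = q + 1) by the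
-- colour x of the first path vertex: either x is new, which gives a colouring of L_{m+1,n}, or x is
-- the colour of exactly one clique vertex j.  Swapping two clique vertices shows that the number S
-- of colourings of the second kind does not depend on j, while excluding only the colour of vertex q
-- gives the colourings of L_{m,n+1}.  Hence
--   X_{K_m} X_{P_{n+1}} = X_{L_{m+1,n}} + m S = X_{L_{m,n+1}} + S,
-- so X_{L_{m+1,n}} + q X_{K_m} X_{P_{n+1}} = m X_{L_{m,n+1}}.  Starting from L_{2,n} = P_{n+2},
-- induction on m unfolds this recurrence into the stated formula.

module Submission where

open import Defs
open import Algebra.Bundles using (CommutativeMonoid)
import Algebra.Properties.CommutativeSemigroup as CommSemigroupProperties
open import Data.Bool using (Bool; true; false; _∧_; _∨_; not; T)
open import Data.Bool.ListAction using (and)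
open import Data.Bool.Properties using (∧-zeroʳ; ∧-identityʳ; ∨-identityʳ; ∧-commutativeMonoid; T-∧)
open import Data.Empty using (⊥-elim)
open import Data.Fin using (Fin; zero; suc; toℕ; fromℕ; _↑ˡ_; _↑ʳ_; splitAt)
open import Data.Fin.Properties using (toℕ<n; toℕ-fromℕ; toℕ-↑ˡ; toℕ-↑ʳ; splitAt⁻¹-↑ˡ; splitAt⁻¹-↑ʳ) renaming (_≟_ to _≟ᶠ_)
open import Data.Integer using () renaming (+_ to pos)
import Data.Integer as ℤ using (_+_)
import Data.Integer.Properties as ℤ
open import Data.List using (List; []; _∷_; _++_; map; concatMap; filterᵇ; length; allFin; foldr; zipWith; upTo; applyUpTo; tabulate)
import Data.List.Properties as List
open import Data.List.Relation.Unary.All as All using (All; []; _∷_)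
import Data.List.Relation.Unary.All.Properties as All
open import Data.Nat hiding (_/_)
open import Data.Nat.Coprimality using (1-coprimeTo) renaming (sym to coprime-sym)
open import Data.Nat.Properties
open import Data.Product using (Σ; _×_; _,_; proj₁; proj₂)
open import Data.Rational using (ℚ; mkℚ; 0ℚ; _/_) renaming (_+_ to _+ℚ_; _*_ to _*ℚ_; _-_ to _-ℚ_; -_ to -ℚ_)
import Data.Rational.Properties as ℚ
import Data.Rational.Unnormalised as ℚᵘ
import Data.Rational.Unnormalised.Properties as ℚᵘ
open import Data.Sum using (_⊎_; inj₁; inj₂)
open import Data.Vec using (Vec; []; _∷_; lookup; head) renaming (_++_ to _++ⱽ_)
import Data.Vec.Properties as Vec
open import Function using (id; Equivalence)
open import Relation.Binary.PropositionalEquality hiding ([_])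
open import Relation.Nullary using (¬_; yes; no)
open import Relation.Nullary.Decidable using (⌊_⌋)
open ≡-Reasoning

open CommSemigroupProperties +-commutativeSemigroup using () renaming (interchange to +-interchange; xy∙z≈xz∙y to +-xy∙z≈xz∙y)
open CommSemigroupProperties *-commutativeSemigroup using () renaming (interchange to *-interchange; xy∙z≈xz∙y to *-xy∙z≈xz∙y)

private variable A B : Set

-- Iverson brackets and finite sums

[_] : Bool → ℕ
[ true ]  = 1
[ false ] = 0

[∧] : ∀ a b → [ a ∧ b ] ≡ [ a ] * [ b ]
[∧] true  b = sym (+-identityʳ [ b ])
[∧] false b = refl

[∧∧]≡[∧]*[] : ∀ a c t → [ (a ∧ c) ∧ t ] ≡ [ a ∧ t ] * [ c ]
[∧∧]≡[∧]*[] a c t = begin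
  [ (a ∧ c) ∧ t ]       ≡⟨ [∧] (a ∧ c) t ⟩
  [ a ∧ c ] * [ t ]     ≡⟨ cong (_* [ t ]) ([∧] a c) ⟩
  [ a ] * [ c ] * [ t ] ≡⟨ *-xy∙z≈xz∙y [ a ] [ c ] [ t ] ⟩
  [ a ] * [ t ] * [ c ] ≡⟨ cong (_* [ c ]) ([∧] a t) ⟨
  [ a ∧ t ] * [ c ]     ∎

[∧]*[∧] : ∀ a x b y → [ a ∧ x ] * [ b ∧ y ] ≡ ([ a ] * [ b ]) * ([ x ] * [ y ])
[∧]*[∧] a x b y = trans (cong₂ _*_ ([∧] a x) ([∧] b y)) (*-interchange [ a ] [ x ] [ b ] [ y ])

[]≡[]*[not]+[]*[] : ∀ b e → [ b ] ≡ [ b ] * [ not e ] + [ b ] * [ e ]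
[]≡[]*[not]+[]*[] true  true  = refl
[]≡[]*[not]+[]*[] true  false = refl
[]≡[]*[not]+[]*[] false e     = refl

[]≡[]*[≡ᵇ0]+[]* : ∀ b n → (T b → n ≤ 1) → [ b ] ≡ [ b ] * [ n ≡ᵇ 0 ] + [ b ] * n
[]≡[]*[≡ᵇ0]+[]* false n             _    = refl
[]≡[]*[≡ᵇ0]+[]* true  0             _    = refl
[]≡[]*[≡ᵇ0]+[]* true  1             _    = refl
[]≡[]*[≡ᵇ0]+[]* true  (suc (suc n)) n≤1 with n≤1 _
... | s≤s ()

∑ : (A → ℕ) → List A → ℕ
∑ f []       = 0
∑ f (x ∷ xs) = f x + ∑ f xs

∑-cong : ∀ {f g : A → ℕ} xs → (∀ x → f x ≡ g x) → ∑ f xs ≡ ∑ g xs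
∑-cong []       f≗g = refl
∑-cong (x ∷ xs) f≗g = cong₂ _+_ (f≗g x) (∑-cong xs f≗g)

∑-+ : ∀ (f g : A → ℕ) xs → ∑ (λ x → f x + g x) xs ≡ ∑ f xs + ∑ g xs
∑-+ f g []       = refl
∑-+ f g (x ∷ xs) = trans (cong (f x + g x +_) (∑-+ f g xs)) (+-interchange (f x) (g x) (∑ f xs) (∑ g xs))

∑-* : ∀ c (f : A → ℕ) xs → ∑ (λ x → c * f x) xs ≡ c * ∑ f xs
∑-* c f []       = sym (*-zeroʳ c)
∑-* c f (x ∷ xs) = trans (cong (c * f x +_) (∑-* c f xs)) (sym (*-distribˡ-+ c (f x) (∑ f xs)))

∑-*ʳ : ∀ c (f : A → ℕ) xs → ∑ (λ x → f x * c) xs ≡ ∑ f xs * c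
∑-*ʳ c f xs = trans (∑-cong xs (λ x → *-comm (f x) c)) (trans (∑-* c f xs) (*-comm c (∑ f xs)))

∑-zero : ∀ (xs : List A) → ∑ (λ _ → 0) xs ≡ 0
∑-zero []       = refl
∑-zero (x ∷ xs) = ∑-zero xs

∑-++ : ∀ (f : A → ℕ) xs ys → ∑ f (xs ++ ys) ≡ ∑ f xs + ∑ f ys
∑-++ f []       ys = refl
∑-++ f (x ∷ xs) ys = trans (cong (f x +_) (∑-++ f xs ys)) (sym (+-assoc (f x) _ _))

∑-map : ∀ (f : B → ℕ) (g : A → B) xs → ∑ f (map g xs) ≡ ∑ (λ x → f (g x)) xs
∑-map f g []       = refl
∑-map f g (x ∷ xs) = cong (f (g x) +_) (∑-map f g xs)

∑-concatMap : ∀ (f : B → ℕ) (g : A → List B) xs → ∑ f (concatMap g xs) ≡ ∑ (λ x → ∑ f (g x)) xs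
∑-concatMap f g []       = refl
∑-concatMap f g (x ∷ xs) = trans (∑-++ f (g x) (concatMap g xs)) (cong (∑ f (g x) +_) (∑-concatMap f g xs))

length-filterᵇ : ∀ (p : A → Bool) xs → length (filterᵇ p xs) ≡ ∑ (λ x → [ p x ]) xs
length-filterᵇ p []       = refl
length-filterᵇ p (x ∷ xs) with p x
... | true  = cong suc (length-filterᵇ p xs)
... | false = length-filterᵇ p xs

∑-swap : ∀ (f : A → B → ℕ) xs ys →
         ∑ (λ x → ∑ (f x) ys) xs ≡ ∑ (λ y → ∑ (λ x → f x y) xs) ys
∑-swap f []       ys = sym (∑-zero ys)
∑-swap f (x ∷ xs) ys = trans (cong (∑ (f x) ys +_) (∑-swap f xs ys)) (sym (∑-+ (f x) _ ys))

∑< : ℕ → (ℕ → ℕ) → ℕ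
∑< zero    F = 0
∑< (suc n) F = F 0 + ∑< n (λ i → F (suc i))

∑<-cong : ∀ n {F G : ℕ → ℕ} → (∀ i → F i ≡ G i) → ∑< n F ≡ ∑< n G
∑<-cong zero    F≗G = refl
∑<-cong (suc n) F≗G = cong₂ _+_ (F≗G 0) (∑<-cong n (λ i → F≗G (suc i)))

∑<-* : ∀ n c (F : ℕ → ℕ) → ∑< n (λ i → c * F i) ≡ c * ∑< n F
∑<-* zero    c F = sym (*-zeroʳ c)
∑<-* (suc n) c F = trans (cong (c * F 0 +_) (∑<-* n c (λ i → F (suc i)))) (sym (*-distribˡ-+ c (F 0) _))

∑<-const : ∀ n (F : ℕ → ℕ) c → (∀ i → i < n → F i ≡ c) → ∑< n F ≡ n * c
∑<-const zero    F c F≡c = refl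
∑<-const (suc n) F c F≡c = cong₂ _+_ (F≡c 0 z<s) (∑<-const n (λ i → F (suc i)) c (λ i i<n → F≡c (suc i) (s<s i<n)))

∑<-zero : ∀ n → ∑< n (λ _ → 0) ≡ 0
∑<-zero zero    = refl
∑<-zero (suc n) = ∑<-zero n

∑<-select : ∀ n t (g : ℕ → ℕ) → ∑< n (λ i → [ t ≡ᵇ i ] * g i) ≡ [ t <ᵇ n ] * g t
∑<-select zero    t       g = refl
∑<-select (suc n) zero    g = trans (cong (g 0 + 0 +_) (∑<-zero n)) (+-identityʳ _)
∑<-select (suc n) (suc t) g = ∑<-select n t (λ i → g (suc i))

∑-applyUpTo : ∀ (g f : ℕ → ℕ) n → ∑ g (applyUpTo f n) ≡ ∑< n (λ i → g (f i))
∑-applyUpTo g f zero    = refl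
∑-applyUpTo g f (suc n) = cong (g (f 0) +_) (∑-applyUpTo g (λ i → f (suc i)) n)

steps⇒≡ : ∀ (S : ℕ → A) {j q} → (∀ i → i < q → S i ≡ S (suc i)) → j ≤′ q → S j ≡ S q
steps⇒≡ S steps ≤′-refl          = refl
steps⇒≡ S steps (≤′-step j≤′q) =
  trans (steps⇒≡ S (λ i i<q → steps i (m<n⇒m<1+n i<q)) j≤′q) (steps _ (n<1+n _))

∑ⱽ : ∀ {k} N → (Vec (Fin k) N → ℕ) → ℕ
∑ⱽ     zero    F = F []
∑ⱽ {k} (suc N) F = ∑ (λ c → ∑ⱽ N (λ κ → F (c ∷ κ))) (allFin k)

swapAt : ∀ {n} → ℕ → Vec A n → Vec A n
swapAt zero    []          = []
swapAt zero    (a ∷ [])    = a ∷ []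
swapAt zero    (a ∷ b ∷ w) = b ∷ a ∷ w
swapAt (suc j) []          = []
swapAt (suc j) (a ∷ w)     = a ∷ swapAt j w

module _ {k : ℕ} where

  ∑ⱽ-cong : ∀ N {F G : Vec (Fin k) N → ℕ} → (∀ κ → F κ ≡ G κ) → ∑ⱽ N F ≡ ∑ⱽ N G
  ∑ⱽ-cong zero    F≗G = F≗G []
  ∑ⱽ-cong (suc N) F≗G = ∑-cong (allFin k) (λ c → ∑ⱽ-cong N (λ κ → F≗G (c ∷ κ)))

  ∑ⱽ-+ : ∀ N (F G : Vec (Fin k) N → ℕ) → ∑ⱽ N (λ κ → F κ + G κ) ≡ ∑ⱽ N F + ∑ⱽ N G
  ∑ⱽ-+ zero    F G = refl
  ∑ⱽ-+ (suc N) F G = trans (∑-cong (allFin k) (λ c → ∑ⱽ-+ N _ _)) (∑-+ _ _ (allFin k))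

  ∑ⱽ-* : ∀ N c (F : Vec (Fin k) N → ℕ) → ∑ⱽ N (λ κ → c * F κ) ≡ c * ∑ⱽ N F
  ∑ⱽ-* zero    c F = refl
  ∑ⱽ-* (suc N) c F = trans (∑-cong (allFin k) (λ a → ∑ⱽ-* N c _)) (∑-* c _ (allFin k))

  ∑ⱽ-zero : ∀ N → ∑ⱽ {k} N (λ _ → 0) ≡ 0
  ∑ⱽ-zero zero    = refl
  ∑ⱽ-zero (suc N) = trans (∑-cong (allFin k) (λ _ → ∑ⱽ-zero N)) (∑-zero (allFin k))

  ∑ⱽ-∑ : ∀ N (F : A → Vec (Fin k) N → ℕ) xs → ∑ⱽ N (λ κ → ∑ (λ x → F x κ) xs) ≡ ∑ (λ x → ∑ⱽ N (F x)) xs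
  ∑ⱽ-∑ N F []       = ∑ⱽ-zero N
  ∑ⱽ-∑ N F (x ∷ xs) = trans (∑ⱽ-+ N (F x) _) (cong (∑ⱽ N (F x) +_) (∑ⱽ-∑ N F xs))

  ∑ⱽ-∑< : ∀ N n (F : ℕ → Vec (Fin k) N → ℕ) → ∑ⱽ N (λ κ → ∑< n (λ i → F i κ)) ≡ ∑< n (λ i → ∑ⱽ N (F i))
  ∑ⱽ-∑< N zero    F = ∑ⱽ-zero N
  ∑ⱽ-∑< N (suc n) F = trans (∑ⱽ-+ N _ _) (cong (∑ⱽ N (F 0) +_) (∑ⱽ-∑< N n (λ i → F (suc i))))

  ∑ⱽ-++ : ∀ M N (F : Vec (Fin k) (M + N) → ℕ) → ∑ⱽ (M + N) F ≡ ∑ⱽ M (λ w → ∑ⱽ N (λ r → F (w ++ⱽ r)))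
  ∑ⱽ-++ zero    N F = refl
  ∑ⱽ-++ (suc M) N F = ∑-cong (allFin k) (λ c → ∑ⱽ-++ M N (λ κ → F (c ∷ κ)))

  ∑ⱽ-product : ∀ M N (F : Vec (Fin k) M → ℕ) (G : Vec (Fin k) N → ℕ) →
               ∑ⱽ M (λ w → ∑ⱽ N (λ r → F w * G r)) ≡ ∑ⱽ M F * ∑ⱽ N G
  ∑ⱽ-product M N F G = begin
    ∑ⱽ M (λ w → ∑ⱽ N (λ r → F w * G r)) ≡⟨ ∑ⱽ-cong M (λ w → trans (∑ⱽ-* N (F w) G) (*-comm (F w) _)) ⟩
    ∑ⱽ M (λ w → ∑ⱽ N G * F w)           ≡⟨ ∑ⱽ-* M (∑ⱽ N G) F ⟩
    ∑ⱽ N G * ∑ⱽ M F                     ≡⟨ *-comm (∑ⱽ N G) _ ⟩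
    ∑ⱽ M F * ∑ⱽ N G                     ∎

  ∑ⱽ-swapAt : ∀ N j (F : Vec (Fin k) N → ℕ) → ∑ⱽ N (λ κ → F (swapAt j κ)) ≡ ∑ⱽ N F
  ∑ⱽ-swapAt zero          zero    F = refl
  ∑ⱽ-swapAt zero          (suc j) F = refl
  ∑ⱽ-swapAt (suc zero)    zero    F = refl
  ∑ⱽ-swapAt (suc (suc N)) zero    F = ∑-swap (λ a b → ∑ⱽ N (λ κ → F (b ∷ a ∷ κ))) (allFin k) (allFin k)
  ∑ⱽ-swapAt (suc N)       (suc j) F = ∑-cong (allFin k) (λ a → ∑ⱽ-swapAt N j (λ κ → F (a ∷ κ)))

length-filterᵇ-maps : ∀ k N (p : Vec (Fin k) N → Bool) → length (filterᵇ p (maps k N)) ≡ ∑ⱽ N (λ κ → [ p κ ])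
length-filterᵇ-maps k zero    p = trans (length-filterᵇ p ([] ∷ [])) (+-identityʳ _)
length-filterᵇ-maps k (suc N) p = begin
  length (filterᵇ p (maps k (suc N)))
    ≡⟨ length-filterᵇ p (maps k (suc N)) ⟩
  ∑ (λ κ → [ p κ ]) (concatMap (λ c → map (c ∷_) (maps k N)) (allFin k))
    ≡⟨ ∑-concatMap _ _ (allFin k) ⟩
  ∑ (λ c → ∑ (λ κ → [ p κ ]) (map (c ∷_) (maps k N))) (allFin k)
    ≡⟨ ∑-cong (allFin k) (λ c → begin
         ∑ (λ κ → [ p κ ]) (map (c ∷_) (maps k N))     ≡⟨ ∑-map _ _ (maps k N) ⟩
         ∑ (λ κ → [ p (c ∷ κ) ]) (maps k N)            ≡⟨ length-filterᵇ _ (maps k N) ⟨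
         length (filterᵇ (λ κ → p (c ∷ κ)) (maps k N)) ≡⟨ length-filterᵇ-maps k N (λ κ → p (c ∷ κ)) ⟩
         ∑ⱽ N (λ κ → [ p (c ∷ κ) ])                    ∎) ⟩
  ∑ⱽ (suc N) (λ κ → [ p κ ]) ∎

-- Colour types

infix 4 _=ᶠ_ _=ᴸ_

_=ᶠ_ : ∀ {k} → Fin k → Fin k → Bool
x =ᶠ y = ⌊ x ≟ᶠ y ⌋

module _ {k : ℕ} {x y : Fin k} where

  ≡⇒=ᶠ : x ≡ y → T (x =ᶠ y)
  ≡⇒=ᶠ x≡y with x ≟ᶠ y
  ... | yes _   = _
  ... | no  x≢y = x≢y x≡y

  =ᶠ⇒≡ : T (x =ᶠ y) → x ≡ y
  =ᶠ⇒≡ t with x ≟ᶠ y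
  ... | yes x≡y = x≡y

  ≢⇒=ᶠ≡false : x ≢ y → (x =ᶠ y) ≡ false
  ≢⇒=ᶠ≡false x≢y with x ≟ᶠ y
  ... | yes x≡y = ⊥-elim (x≢y x≡y)
  ... | no  _   = refl

occurrences : ∀ {k N} → Vec (Fin k) N → Fin k → ℕ
occurrences []      c = 0
occurrences (x ∷ κ) c = [ x =ᶠ c ] + occurrences κ c

colourType : ∀ {k N} → Vec (Fin k) N → List ℕ
colourType {k} κ = tabulate {n = k} (occurrences κ)

_=ᴸ_ : List ℕ → List ℕ → Bool
[]       =ᴸ []       = true
[]       =ᴸ (y ∷ ys) = false
(x ∷ xs) =ᴸ []       = false
(x ∷ xs) =ᴸ (y ∷ ys) = (x ≡ᵇ y) ∧ (xs =ᴸ ys)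

∑-tabulate-occurrences : ∀ {k N} (κ : Vec (Fin k) N) c (h : A → ℕ) (g : Fin N → A) →
                         (∀ i → h (g i) ≡ [ lookup κ i =ᶠ c ]) → ∑ h (tabulate g) ≡ occurrences κ c
∑-tabulate-occurrences []      c h g hg = refl
∑-tabulate-occurrences (x ∷ κ) c h g hg =
  cong₂ _+_ (hg zero) (∑-tabulate-occurrences κ c h (λ i → g (suc i)) (λ i → hg (suc i)))

classSize≡occurrences : ∀ {k N} (κ : Vec (Fin k) N) c → classSize κ c ≡ occurrences κ c
classSize≡occurrences {N = N} κ c =
  trans (length-filterᵇ _ (allFin N)) (∑-tabulate-occurrences κ c _ (λ i → i) (λ i → refl))

and-tabulate-≡ᵇ : ∀ (a : List ℕ) (h : Fin (length a) → ℕ) →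
                  and (tabulate (λ c → h c ≡ᵇ Data.List.lookup a c)) ≡ (tabulate h =ᴸ a)
and-tabulate-≡ᵇ []      h = refl
and-tabulate-≡ᵇ (x ∷ a) h = cong ((h zero ≡ᵇ x) ∧_) (and-tabulate-≡ᵇ a (λ i → h (suc i)))

hasType≡colourType : ∀ {N} (a : List ℕ) (κ : Vec (Fin (length a)) N) → hasType a κ ≡ (colourType κ =ᴸ a)
hasType≡colourType a κ = begin
  and (map (λ c → classSize κ c ≡ᵇ Data.List.lookup a c) (allFin (length a)))
    ≡⟨ cong and (List.map-tabulate (λ i → i) (λ c → classSize κ c ≡ᵇ Data.List.lookup a c)) ⟩
  and (tabulate (λ c → classSize κ c ≡ᵇ Data.List.lookup a c))
    ≡⟨ cong and (List.tabulate-cong (λ c → cong (_≡ᵇ Data.List.lookup a c) (classSize≡occurrences κ c))) ⟩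
  and (tabulate (λ c → occurrences κ c ≡ᵇ Data.List.lookup a c))
    ≡⟨ and-tabulate-≡ᵇ a (occurrences κ) ⟩
  (colourType κ =ᴸ a) ∎

occurrences-++ : ∀ {k M N} (w : Vec (Fin k) M) (r : Vec (Fin k) N) c →
                 occurrences (w ++ⱽ r) c ≡ occurrences w c + occurrences r c
occurrences-++ []      r c = refl
occurrences-++ (x ∷ w) r c = trans (cong ([ x =ᶠ c ] +_) (occurrences-++ w r c)) (sym (+-assoc [ x =ᶠ c ] _ _))

occurrences-swapAt : ∀ {k N} j (w : Vec (Fin k) N) c → occurrences (swapAt j w) c ≡ occurrences w c
occurrences-swapAt zero    []          c = refl
occurrences-swapAt zero    (a ∷ [])    c = refl
occurrences-swapAt zero    (a ∷ b ∷ w) c = begin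
  [ b =ᶠ c ] + ([ a =ᶠ c ] + occurrences w c) ≡⟨ +-assoc [ b =ᶠ c ] _ _ ⟨
  [ b =ᶠ c ] + [ a =ᶠ c ] + occurrences w c   ≡⟨ cong (_+ occurrences w c) (+-comm [ b =ᶠ c ] _) ⟩
  [ a =ᶠ c ] + [ b =ᶠ c ] + occurrences w c   ≡⟨ +-assoc [ a =ᶠ c ] _ _ ⟩
  [ a =ᶠ c ] + ([ b =ᶠ c ] + occurrences w c) ∎
occurrences-swapAt (suc j) []      c = refl
occurrences-swapAt (suc j) (a ∷ w) c = cong ([ a =ᶠ c ] +_) (occurrences-swapAt j w c)

tabulate-+ : ∀ {k} (f g : Fin k → ℕ) → tabulate (λ c → f c + g c) ≡ zipWith _+_ (tabulate f) (tabulate g)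
tabulate-+ {zero}  f g = refl
tabulate-+ {suc k} f g = cong (f zero + g zero ∷_) (tabulate-+ (λ i → f (suc i)) (λ i → g (suc i)))

colourType-++ : ∀ {k M N} (w : Vec (Fin k) M) (r : Vec (Fin k) N) →
                colourType (w ++ⱽ r) ≡ zipWith _+_ (colourType w) (colourType r)
colourType-++ w r = trans (List.tabulate-cong (occurrences-++ w r)) (tabulate-+ (occurrences w) (occurrences r))

colourType-swapAt : ∀ {k N} j (w : Vec (Fin k) N) → colourType (swapAt j w) ≡ colourType w
colourType-swapAt j w = List.tabulate-cong (occurrences-swapAt j w)

length-colourType : ∀ {k N} (w : Vec (Fin k) N) → length (colourType w) ≡ k
length-colourType w = List.length-tabulate (occurrences w)

-- Proper colourings

T-ext : ∀ {x y} → (T x → T y) → (T y → T x) → x ≡ y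
T-ext {true}  {true}  x⇒y y⇒x = refl
T-ext {true}  {false} x⇒y y⇒x = ⊥-elim (x⇒y _)
T-ext {false} {true}  x⇒y y⇒x = ⊥-elim (y⇒x _)
T-ext {false} {false} x⇒y y⇒x = refl

T-∧⁻ : ∀ {x y} → T (x ∧ y) → T x × T y
T-∧⁻ = Equivalence.to T-∧

T-∧⁺ : ∀ {x y} → T x → T y → T (x ∧ y)
T-∧⁺ tx ty = Equivalence.from T-∧ (tx , ty)

T-not⇒¬T : ∀ {b} → T (not b) → ¬ T b
T-not⇒¬T {false} _ ()

¬T⇒T-not : ∀ {b} → ¬ T b → T (not b)
¬T⇒T-not {true}  ¬t = ¬t _
¬T⇒T-not {false} ¬t = _

T⇒[]≡1 : ∀ {b} → T b → [ b ] ≡ 1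
T⇒[]≡1 {true} _ = refl

T-and⁻ : ∀ xs → T (and xs) → All T xs
T-and⁻ []           _ = []
T-and⁻ (true  ∷ xs) t = _ ∷ T-and⁻ xs t

T-and⁺ : ∀ {xs} → All T xs → T (and xs)
T-and⁺ []                 = _
T-and⁺ (_∷_ {true}  _  ts) = T-and⁺ ts
T-and⁺ (_∷_ {false} () _)

graphOn : ℕ → (ℕ → ℕ → Bool) → Graph
graphOn N f = record { N = N ; adj = λ u v → f (toℕ u) (toℕ v) }

isProper : ∀ {k} N → (ℕ → ℕ → Bool) → Vec (Fin k) N → Bool
isProper N f = proper (graphOn N f)

Proper : ∀ {k N} → (ℕ → ℕ → Bool) → Vec (Fin k) N → Set
Proper {N = N} f κ = ∀ (u v : Fin N) → T (f (toℕ u) (toℕ v)) → lookup κ u ≢ lookup κ v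

isProper-cong : ∀ {k} N (f g : ℕ → ℕ → Bool) (κ : Vec (Fin k) N) →
                (∀ (u v : Fin N) → f (toℕ u) (toℕ v) ≡ g (toℕ u) (toℕ v)) → isProper N f κ ≡ isProper N g κ
isProper-cong N f g κ f≗g = cong and (List.concatMap-cong
  (λ u → List.map-cong (λ v → cong (λ b → not b ∨ not (lookup κ u =ᶠ lookup κ v)) (f≗g u v)) (allFin N)) (allFin N))

module _ {k : ℕ} (N : ℕ) (f : ℕ → ℕ → Bool) (κ : Vec (Fin k) N) where

  isProper⇒Proper : T (isProper N f κ) → Proper f κ
  isProper⇒Proper t u v = entry (f (toℕ u) (toℕ v))
    (All.tabulate⁻ (All.map⁻ (All.tabulate⁻ (All.map⁻ {xs = allFin N} (All.concat⁻ (T-and⁻ _ t))) u)) v)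
    where
    entry : ∀ a → T (not a ∨ not (lookup κ u =ᶠ lookup κ v)) → T a → lookup κ u ≢ lookup κ v
    entry true t _ κu≡κv with lookup κ u ≟ᶠ lookup κ v
    ... | no κu≢κv = κu≢κv κu≡κv

  Proper⇒isProper : Proper f κ → T (isProper N f κ)
  Proper⇒isProper p = T-and⁺ (All.concat⁺ (All.map⁺ (All.tabulate⁺ (λ u →
    All.map⁺ (All.tabulate⁺ (λ v → entry (f (toℕ u) (toℕ v)) (p u v)))))))
    where
    entry : ∀ {u v} a → (T a → lookup κ u ≢ lookup κ v) → T (not a ∨ not (lookup κ u =ᶠ lookup κ v))
    entry false _ = _
    entry {u} {v} true a⇒≢ with lookup κ u ≟ᶠ lookup κ v
    ... | yes κu≡κv = a⇒≢ _ κu≡κv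
    ... | no  _     = _

splitAt-view : ∀ m {n} (u : Fin (m + n)) → (Σ (Fin m) λ i → i ↑ˡ n ≡ u) ⊎ (Σ (Fin n) λ j → m ↑ʳ j ≡ u)
splitAt-view m {n} u with splitAt m {n} u in eq
... | inj₁ i = inj₁ (i , splitAt⁻¹-↑ˡ eq)
... | inj₂ j = inj₂ (j , splitAt⁻¹-↑ʳ eq)

CrossProper : ∀ {k m n} → (ℕ → ℕ → Bool) → Vec (Fin k) m → Vec (Fin k) n → Set
CrossProper {m = m} {n} c w r = ∀ (i : Fin m) (j : Fin n) → T (c (toℕ i) (toℕ j)) → lookup w i ≢ lookup r j

module Concatenation {k m n : ℕ} (f g h c : ℕ → ℕ → Bool)
  (f-left   : ∀ (i j : Fin m) → f (toℕ i) (toℕ j) ≡ g (toℕ i) (toℕ j))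
  (f-right  : ∀ (i j : Fin n) → f (m + toℕ i) (m + toℕ j) ≡ h (toℕ i) (toℕ j))
  (f-cross  : ∀ (i : Fin m) (j : Fin n) → f (toℕ i) (m + toℕ j) ≡ c (toℕ i) (toℕ j))
  (f-cross′ : ∀ (i : Fin m) (j : Fin n) → f (m + toℕ j) (toℕ i) ≡ c (toℕ i) (toℕ j))
  (w : Vec (Fin k) m) (r : Vec (Fin k) n) where

  private
    left-adj : ∀ i j → T (f (toℕ (i ↑ˡ n)) (toℕ (j ↑ˡ n))) ≡ T (g (toℕ i) (toℕ j))
    left-adj i j = cong T (trans (cong₂ f (toℕ-↑ˡ i n) (toℕ-↑ˡ j n)) (f-left i j))
    right-adj : ∀ i j → T (f (toℕ (m ↑ʳ i)) (toℕ (m ↑ʳ j))) ≡ T (h (toℕ i) (toℕ j))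
    right-adj i j = cong T (trans (cong₂ f (toℕ-↑ʳ m i) (toℕ-↑ʳ m j)) (f-right i j))
    cross-adj : ∀ i j → T (f (toℕ (i ↑ˡ n)) (toℕ (m ↑ʳ j))) ≡ T (c (toℕ i) (toℕ j))
    cross-adj i j = cong T (trans (cong₂ f (toℕ-↑ˡ i n) (toℕ-↑ʳ m j)) (f-cross i j))
    cross-adj′ : ∀ i j → T (f (toℕ (m ↑ʳ j)) (toℕ (i ↑ˡ n))) ≡ T (c (toℕ i) (toℕ j))
    cross-adj′ i j = cong T (trans (cong₂ f (toℕ-↑ʳ m j) (toℕ-↑ˡ i n)) (f-cross′ i j))
    lookup-left : ∀ i → lookup (w ++ⱽ r) (i ↑ˡ n) ≡ lookup w i
    lookup-left = Vec.lookup-++ˡ w r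
    lookup-right : ∀ j → lookup (w ++ⱽ r) (m ↑ʳ j) ≡ lookup r j
    lookup-right = Vec.lookup-++ʳ w r

  Proper-++⁻ : Proper f (w ++ⱽ r) → Proper g w × Proper h r × CrossProper c w r
  Proper-++⁻ p =
    (λ i j e eq → p (i ↑ˡ n) (j ↑ˡ n) (subst id (sym (left-adj i j)) e) (trans (lookup-left i) (trans eq (sym (lookup-left j))))) ,
    (λ i j e eq → p (m ↑ʳ i) (m ↑ʳ j) (subst id (sym (right-adj i j)) e) (trans (lookup-right i) (trans eq (sym (lookup-right j))))) ,
    (λ i j e eq → p (i ↑ˡ n) (m ↑ʳ j) (subst id (sym (cross-adj i j)) e) (trans (lookup-left i) (trans eq (sym (lookup-right j)))))

  Proper-++⁺ : Proper g w × Proper h r × CrossProper c w r → Proper f (w ++ⱽ r)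
  Proper-++⁺ (pg , ph , pc) u v e eq with splitAt-view m u | splitAt-view m v
  ... | inj₁ (i , refl) | inj₁ (j , refl) = pg i j (subst id (left-adj i j) e) (trans (sym (lookup-left i)) (trans eq (lookup-left j)))
  ... | inj₂ (i , refl) | inj₂ (j , refl) = ph i j (subst id (right-adj i j) e) (trans (sym (lookup-right i)) (trans eq (lookup-right j)))
  ... | inj₁ (i , refl) | inj₂ (j , refl) = pc i j (subst id (cross-adj i j) e) (trans (sym (lookup-left i)) (trans eq (lookup-right j)))
  ... | inj₂ (j , refl) | inj₁ (i , refl) = pc i j (subst id (cross-adj′ i j) e) (trans (sym (lookup-left i)) (trans (sym eq) (lookup-right j)))

  isProper-++ : ∀ {b} → (T b → CrossProper c w r) → (CrossProper c w r → T b) →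
                isProper (m + n) f (w ++ⱽ r) ≡ (isProper m g w ∧ isProper n h r) ∧ b
  isProper-++ b⇒cross cross⇒b = T-ext
    (λ t → let (pw , pr , pc) = Proper-++⁻ (isProper⇒Proper (m + n) f (w ++ⱽ r) t) in
           T-∧⁺ (T-∧⁺ (Proper⇒isProper m g w pw) (Proper⇒isProper n h r pr)) (cross⇒b pc))
    (λ t → let (twr , tb) = T-∧⁻ t ; (tw , tr) = T-∧⁻ twr in
           Proper⇒isProper (m + n) f (w ++ⱽ r) (Proper-++⁺ (isProper⇒Proper m g w tw , isProper⇒Proper n h r tr , b⇒cross tb)))

-- Adjacency in lollipops

clique : ℕ → ℕ → Bool
clique i j = not (i ≡ᵇ j)

unionAdj : ℕ → ℕ → ℕ → Bool
unionAdj m u v =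
  ((u <ᵇ m) ∧ (v <ᵇ m) ∧ not (u ≡ᵇ v))
  ∨ ((m ≤ᵇ u) ∧ (v ≡ᵇ suc u))
  ∨ ((m ≤ᵇ v) ∧ (u ≡ᵇ suc v))

private
  T⇒≡true : ∀ {b} → T b → b ≡ true
  T⇒≡true {true} _ = refl

  ¬T⇒≡false : ∀ {b} → ¬ T b → b ≡ false
  ¬T⇒≡false {true}  ¬t = ⊥-elim (¬t _)
  ¬T⇒≡false {false} ¬t = refl

<⇒<ᵇ≡true : ∀ {i m} → i < m → (i <ᵇ m) ≡ true
<⇒<ᵇ≡true i<m = T⇒≡true (<⇒<ᵇ i<m)

<⇒≤ᵇ≡false : ∀ {i m} → i < m → (m ≤ᵇ i) ≡ false
<⇒≤ᵇ≡false {i} {m} i<m = ¬T⇒≡false (λ t → <⇒≱ i<m (≤ᵇ⇒≤ m i t))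

≢⇒≡ᵇ≡false : ∀ {i j} → i ≢ j → (i ≡ᵇ j) ≡ false
≢⇒≡ᵇ≡false {i} {j} i≢j = ¬T⇒≡false (λ t → i≢j (≡ᵇ⇒≡ i j t))

≤ᵇ-suc : ∀ m u → (suc m ≤ᵇ suc u) ≡ (m ≤ᵇ u)
≤ᵇ-suc zero    u = refl
≤ᵇ-suc (suc m) u = refl

+<ᵇ≡false : ∀ m j → (m + j <ᵇ m) ≡ false
+<ᵇ≡false zero    j = refl
+<ᵇ≡false (suc m) j = +<ᵇ≡false m j

+<ᵇsuc : ∀ m j → (m + j <ᵇ suc m) ≡ (j ≡ᵇ 0)
+<ᵇsuc zero    zero    = refl
+<ᵇsuc zero    (suc j) = refl
+<ᵇsuc (suc m) j       = +<ᵇsuc m j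

no-path-edge-below : ∀ m i j → suc j ≤ m → ((m ∸ 1 ≤ᵇ i) ∧ (j ≡ᵇ suc i)) ≡ false
no-path-edge-below (suc m) i j j<m with j ≟ suc i
... | yes refl rewrite <⇒≤ᵇ≡false {i} {m} (s≤s⁻¹ j<m) = refl
... | no  j≢i+1 rewrite ≢⇒≡ᵇ≡false j≢i+1 = ∧-zeroʳ _

lolliAdj-clique : ∀ m i j → i < m → j < m → lolliAdj m i j ≡ clique i j
lolliAdj-clique m i j i<m j<m
  rewrite <⇒<ᵇ≡true i<m | <⇒<ᵇ≡true j<m | no-path-edge-below m i j j<m | no-path-edge-below m j i i<m
  = ∨-identityʳ _

lolliAdj-suc-clique : ∀ m i j → i < m → j < m → lolliAdj (suc m) i j ≡ clique i j
lolliAdj-suc-clique m i j i<m j<m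
  rewrite <⇒<ᵇ≡true (m<n⇒m<1+n i<m) | <⇒<ᵇ≡true (m<n⇒m<1+n j<m) | <⇒≤ᵇ≡false i<m | <⇒≤ᵇ≡false j<m
  = ∨-identityʳ _

unionAdj-clique : ∀ m i j → i < m → j < m → unionAdj m i j ≡ clique i j
unionAdj-clique m i j i<m j<m
  rewrite <⇒<ᵇ≡true i<m | <⇒<ᵇ≡true j<m | <⇒≤ᵇ≡false i<m | <⇒≤ᵇ≡false j<m
  = ∨-identityʳ _

lolliAdj-1 : ∀ u v → lolliAdj 1 u v ≡ lolliAdj 0 u v
lolliAdj-1 zero    zero    = refl
lolliAdj-1 zero    (suc v) = refl
lolliAdj-1 (suc u) v       = refl

lolliAdj-suc-suc : ∀ m u v → lolliAdj (suc m) (suc u) (suc v) ≡ lolliAdj m u v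
lolliAdj-suc-suc zero    u v = refl
lolliAdj-suc-suc (suc m) u v rewrite ≤ᵇ-suc m u | ≤ᵇ-suc m v = refl

unionAdj-suc-suc : ∀ m u v → unionAdj (suc m) (suc u) (suc v) ≡ unionAdj m u v
unionAdj-suc-suc m u v rewrite ≤ᵇ-suc m u | ≤ᵇ-suc m v = refl

lolliAdj-tail : ∀ m i j → lolliAdj m (m + i) (m + j) ≡ lolliAdj 0 i j
lolliAdj-tail zero    i j = refl
lolliAdj-tail (suc m) i j = trans (lolliAdj-suc-suc m (m + i) (m + j)) (lolliAdj-tail m i j)

lolliAdj-suc-tail : ∀ m i j → lolliAdj (suc m) (m + i) (m + j) ≡ lolliAdj 0 i j
lolliAdj-suc-tail zero    i j = lolliAdj-1 i j
lolliAdj-suc-tail (suc m) i j = trans (lolliAdj-suc-suc (suc m) (m + i) (m + j)) (lolliAdj-suc-tail m i j)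

unionAdj-tail : ∀ m i j → unionAdj m (m + i) (m + j) ≡ lolliAdj 0 i j
unionAdj-tail zero    i j = refl
unionAdj-tail (suc m) i j = trans (unionAdj-suc-suc m (m + i) (m + j)) (unionAdj-tail m i j)

unionAdj-cross : ∀ m i j → i < m → unionAdj m i (m + j) ≡ false
unionAdj-cross (suc m) zero    j _ rewrite +<ᵇ≡false m j = ∧-zeroʳ _
unionAdj-cross (suc m) (suc i) j i<m = trans (unionAdj-suc-suc m i (m + j)) (unionAdj-cross m i j (s≤s⁻¹ i<m))

unionAdj-cross′ : ∀ m i j → i < m → unionAdj m (m + j) i ≡ false
unionAdj-cross′ (suc m) zero    j _ rewrite +<ᵇ≡false m j | ∧-zeroʳ (suc m ≤ᵇ suc (m + j)) = refl
unionAdj-cross′ (suc m) (suc i) j i<m = trans (unionAdj-suc-suc m (m + j) i) (unionAdj-cross′ m i j (s≤s⁻¹ i<m))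

lolliAdj-suc-cross : ∀ m i j → i < m → lolliAdj (suc m) i (m + j) ≡ (j ≡ᵇ 0)
lolliAdj-suc-cross (suc m) zero j _ rewrite +<ᵇsuc m j | ∧-zeroʳ (suc m ≤ᵇ suc (m + j)) =
  trans (∨-identityʳ _) (∧-identityʳ _)
lolliAdj-suc-cross (suc m) (suc i) j i<m =
  trans (lolliAdj-suc-suc (suc m) i (m + j)) (lolliAdj-suc-cross m i j (s≤s⁻¹ i<m))

lolliAdj-suc-cross′ : ∀ m i j → i < m → lolliAdj (suc m) (m + j) i ≡ (j ≡ᵇ 0)
lolliAdj-suc-cross′ (suc m) zero j _ rewrite +<ᵇsuc m j | ∧-zeroʳ (suc m ≤ᵇ suc (m + j)) =
  trans (∨-identityʳ _) (∧-identityʳ _)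
lolliAdj-suc-cross′ (suc m) (suc i) j i<m =
  trans (lolliAdj-suc-suc (suc m) (m + j) i) (lolliAdj-suc-cross′ m i j (s≤s⁻¹ i<m))

lolliAdj-cross : ∀ q i j → i < suc q → lolliAdj (suc q) i (suc q + j) ≡ ((i ≡ᵇ q) ∧ (j ≡ᵇ 0))
lolliAdj-cross zero    zero    j _ rewrite ∧-zeroʳ (0 ≤ᵇ suc j) = ∨-identityʳ _
lolliAdj-cross (suc q) zero    j _ rewrite +<ᵇ≡false q j | ∧-zeroʳ (suc q ≤ᵇ suc (suc (q + j))) = refl
lolliAdj-cross zero    (suc i) j (s≤s ())
lolliAdj-cross (suc q) (suc i) j i<q =
  trans (lolliAdj-suc-suc (suc q) i (suc q + j)) (lolliAdj-cross q i j (s≤s⁻¹ i<q))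

lolliAdj-cross′ : ∀ q i j → i < suc q → lolliAdj (suc q) (suc q + j) i ≡ ((i ≡ᵇ q) ∧ (j ≡ᵇ 0))
lolliAdj-cross′ zero    zero    j _ rewrite ∧-zeroʳ (0 ≤ᵇ suc j) = refl
lolliAdj-cross′ (suc q) zero    j _ rewrite +<ᵇ≡false q j | ∧-zeroʳ (suc q ≤ᵇ suc (suc (q + j))) = refl
lolliAdj-cross′ zero    (suc i) j (s≤s ())
lolliAdj-cross′ (suc q) (suc i) j i<q =
  trans (lolliAdj-suc-suc (suc q) (suc q + j) i) (lolliAdj-cross′ q i j (s≤s⁻¹ i<q))

-- Colourings of a clique

=ᶠ-sym : ∀ {k} (x y : Fin k) → (x =ᶠ y) ≡ (y =ᶠ x)
=ᶠ-sym x y = T-ext (λ t → ≡⇒=ᶠ (sym (=ᶠ⇒≡ t))) (λ t → ≡⇒=ᶠ (sym (=ᶠ⇒≡ t)))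

allDistinct : ∀ {k n} → Vec (Fin k) n → Bool
allDistinct []      = true
allDistinct (a ∷ w) = (occurrences w a ≡ᵇ 0) ∧ allDistinct w

module _ {k : ℕ} where

  occurrences≡0⇒≢ : ∀ {n} (w : Vec (Fin k) n) x → occurrences w x ≡ 0 → ∀ i → lookup w i ≢ x
  occurrences≡0⇒≢ (a ∷ w) x e zero    a≡x =
    1+n≢0 (trans (cong (_+ occurrences w x) (sym (T⇒[]≡1 (≡⇒=ᶠ a≡x)))) e)
  occurrences≡0⇒≢ (a ∷ w) x e (suc i) = occurrences≡0⇒≢ w x (m+n≡0⇒n≡0 [ a =ᶠ x ] e) i

  ≢⇒occurrences≡0 : ∀ {n} (w : Vec (Fin k) n) x → (∀ i → lookup w i ≢ x) → occurrences w x ≡ 0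
  ≢⇒occurrences≡0 []      x w≢x = refl
  ≢⇒occurrences≡0 (a ∷ w) x w≢x rewrite ≢⇒=ᶠ≡false (w≢x zero) = ≢⇒occurrences≡0 w x (λ i → w≢x (suc i))

  allDistinct⇒Proper : ∀ {n} (w : Vec (Fin k) n) → T (allDistinct w) → Proper clique w
  allDistinct⇒Proper (a ∷ w) d zero    (suc v) _ a≡wv =
    occurrences≡0⇒≢ w a (≡ᵇ⇒≡ _ 0 (proj₁ (T-∧⁻ d))) v (sym a≡wv)
  allDistinct⇒Proper (a ∷ w) d (suc u) zero    _ wu≡a =
    occurrences≡0⇒≢ w a (≡ᵇ⇒≡ _ 0 (proj₁ (T-∧⁻ d))) u wu≡a
  allDistinct⇒Proper (a ∷ w) d (suc u) (suc v) t wu≡wv = allDistinct⇒Proper w (proj₂ (T-∧⁻ d)) u v t wu≡wv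

  Proper⇒allDistinct : ∀ {n} (w : Vec (Fin k) n) → Proper clique w → T (allDistinct w)
  Proper⇒allDistinct []      p = _
  Proper⇒allDistinct (a ∷ w) p = T-∧⁺
    (≡⇒≡ᵇ _ 0 (≢⇒occurrences≡0 w a (λ i wi≡a → p zero (suc i) _ (sym wi≡a))))
    (Proper⇒allDistinct w (λ u v → p (suc u) (suc v)))

  allDistinct-swapAt : ∀ {n} j (w : Vec (Fin k) n) → allDistinct (swapAt j w) ≡ allDistinct w
  allDistinct-swapAt zero    []          = refl
  allDistinct-swapAt zero    (a ∷ [])    = refl
  allDistinct-swapAt zero    (a ∷ b ∷ w) rewrite =ᶠ-sym a b with b =ᶠ a
  ... | true  = refl
  ... | false = x∙yz≈y∙xz (occurrences w b ≡ᵇ 0) (occurrences w a ≡ᵇ 0) (allDistinct w)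
    where open CommSemigroupProperties (CommutativeMonoid.commutativeSemigroup ∧-commutativeMonoid)
  allDistinct-swapAt (suc j) []      = refl
  allDistinct-swapAt (suc j) (a ∷ w) rewrite occurrences-swapAt j w a | allDistinct-swapAt j w = refl

  allDistinct⇒occurrences≤1 : ∀ {n} (w : Vec (Fin k) n) x → T (allDistinct w) → occurrences w x ≤ 1
  allDistinct⇒occurrences≤1 []      x d = z≤n
  allDistinct⇒occurrences≤1 (a ∷ w) x d with a =ᶠ x in a=x
  ... | false = allDistinct⇒occurrences≤1 w x (proj₂ (T-∧⁻ d))
  ... | true rewrite sym (=ᶠ⇒≡ {x = a} {x} (subst T (sym a=x) _)) =
    s≤s (≤-reflexive (≡ᵇ⇒≡ _ 0 (proj₁ (T-∧⁻ d))))

-- hasColourAt w j x is false for j out of range.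
hasColourAt : ∀ {k n} → Vec (Fin k) n → ℕ → Fin k → Bool
hasColourAt []      _       _ = false
hasColourAt (a ∷ w) zero    x = a =ᶠ x
hasColourAt (a ∷ w) (suc j) x = hasColourAt w j x

module _ {k : ℕ} where

  hasColourAt-lookup : ∀ {n} (w : Vec (Fin k) n) i x → hasColourAt w (toℕ i) x ≡ (lookup w i =ᶠ x)
  hasColourAt-lookup (a ∷ w) zero    x = refl
  hasColourAt-lookup (a ∷ w) (suc i) x = hasColourAt-lookup w i x

  hasColourAt-swapAt : ∀ {n} j (w : Vec (Fin k) n) x → suc j < n → hasColourAt (swapAt j w) j x ≡ hasColourAt w (suc j) x
  hasColourAt-swapAt zero    (a ∷ b ∷ w) x _   = refl
  hasColourAt-swapAt zero    (a ∷ [])    x (s≤s ())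
  hasColourAt-swapAt (suc j) (a ∷ w)     x j<n = hasColourAt-swapAt j w x (s≤s⁻¹ j<n)

  occurrences≡∑<hasColourAt : ∀ {n} (w : Vec (Fin k) n) x → occurrences w x ≡ ∑< n (λ j → [ hasColourAt w j x ])
  occurrences≡∑<hasColourAt []      x = refl
  occurrences≡∑<hasColourAt (a ∷ w) x = cong ([ a =ᶠ x ] +_) (occurrences≡∑<hasColourAt w x)

isProper-clique : ∀ {k m} (w : Vec (Fin k) m) → isProper m clique w ≡ allDistinct w
isProper-clique {m = m} w = T-ext
  (λ t → Proper⇒allDistinct w (isProper⇒Proper m clique w t))
  (λ t → Proper⇒isProper m clique w (allDistinct⇒Proper w t))

isProper-K : ∀ {k} m (w : Vec (Fin k) m) → isProper m (lolliAdj m) w ≡ allDistinct w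
isProper-K m w = trans (isProper-cong m (lolliAdj m) clique w (λ u v → lolliAdj-clique m _ _ (toℕ<n u) (toℕ<n v))) (isProper-clique w)

module _ {k m n : ℕ} (w : Vec (Fin k) m) where

  isProper-union : ∀ (r : Vec (Fin k) n) →
                   isProper (m + n) (unionAdj m) (w ++ⱽ r) ≡ allDistinct w ∧ isProper n (lolliAdj 0) r
  isProper-union r = begin
    isProper (m + n) (unionAdj m) (w ++ⱽ r)                  ≡⟨ isProper-++ {b = true} (λ _ _ _ ()) _ ⟩
    (isProper m clique w ∧ isProper n (lolliAdj 0) r) ∧ true ≡⟨ ∧-identityʳ _ ⟩
    isProper m clique w ∧ isProper n (lolliAdj 0) r          ≡⟨ cong (_∧ _) (isProper-clique w) ⟩
    allDistinct w ∧ isProper n (lolliAdj 0) r                ∎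
    where
    open Concatenation (unionAdj m) clique (lolliAdj 0) (λ _ _ → false)
      (λ i j → unionAdj-clique m _ _ (toℕ<n i) (toℕ<n j)) (λ i j → unionAdj-tail m _ _)
      (λ i j → unionAdj-cross m _ _ (toℕ<n i)) (λ i j → unionAdj-cross′ m _ _ (toℕ<n i)) w r

  -- In L_{m+1,n} the vertex x is both the last clique vertex and the first path vertex.
  isProper-lollipop-suc : ∀ x (r : Vec (Fin k) n) →
    isProper (m + suc n) (lolliAdj (suc m)) (w ++ⱽ x ∷ r)
      ≡ (allDistinct w ∧ isProper (suc n) (lolliAdj 0) (x ∷ r)) ∧ (occurrences w x ≡ᵇ 0)
  isProper-lollipop-suc x r = trans (isProper-++ b⇒cross cross⇒b)
    (cong (λ d → (d ∧ isProper (suc n) (lolliAdj 0) (x ∷ r)) ∧ (occurrences w x ≡ᵇ 0)) (isProper-clique w))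
    where
    open Concatenation (lolliAdj (suc m)) clique (lolliAdj 0) (λ _ j → j ≡ᵇ 0)
      (λ i j → lolliAdj-suc-clique m _ _ (toℕ<n i) (toℕ<n j)) (λ i j → lolliAdj-suc-tail m _ _)
      (λ i j → lolliAdj-suc-cross m _ _ (toℕ<n i)) (λ i j → lolliAdj-suc-cross′ m _ _ (toℕ<n i)) w (x ∷ r)
    b⇒cross : T (occurrences w x ≡ᵇ 0) → CrossProper (λ _ j → j ≡ᵇ 0) w (x ∷ r)
    b⇒cross t i zero _ = occurrences≡0⇒≢ w x (≡ᵇ⇒≡ _ 0 t) i
    cross⇒b : CrossProper (λ _ j → j ≡ᵇ 0) w (x ∷ r) → T (occurrences w x ≡ᵇ 0)
    cross⇒b cp = ≡⇒≡ᵇ _ 0 (≢⇒occurrences≡0 w x (λ i → cp i zero _))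

module _ {k q n : ℕ} (w : Vec (Fin k) (suc q)) where

  -- In L_{q+1,n+1} the path x ∷ r is attached to the last clique vertex q.
  isProper-lollipop : ∀ x (r : Vec (Fin k) n) →
    isProper (suc q + suc n) (lolliAdj (suc q)) (w ++ⱽ x ∷ r)
      ≡ (allDistinct w ∧ isProper (suc n) (lolliAdj 0) (x ∷ r)) ∧ not (hasColourAt w q x)
  isProper-lollipop x r = trans (isProper-++ b⇒cross cross⇒b)
    (cong (λ d → (d ∧ isProper (suc n) (lolliAdj 0) (x ∷ r)) ∧ not (hasColourAt w q x)) (isProper-clique w))
    where
    c : ℕ → ℕ → Bool
    c i j = (i ≡ᵇ q) ∧ (j ≡ᵇ 0)
    open Concatenation (lolliAdj (suc q)) clique (lolliAdj 0) c
      (λ i j → lolliAdj-clique (suc q) _ _ (toℕ<n i) (toℕ<n j)) (λ i j → lolliAdj-tail (suc q) _ _)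
      (λ i j → lolliAdj-cross q _ _ (toℕ<n i)) (λ i j → lolliAdj-cross′ q _ _ (toℕ<n i)) w (x ∷ r)
    hasColourAt-last : hasColourAt w q x ≡ (lookup w (fromℕ q) =ᶠ x)
    hasColourAt-last = trans (cong (λ j → hasColourAt w j x) (sym (toℕ-fromℕ q))) (hasColourAt-lookup w (fromℕ q) x)
    b⇒cross : T (not (hasColourAt w q x)) → CrossProper c w (x ∷ r)
    b⇒cross t i zero    ci wi≡x = T-not⇒¬T
      (subst (λ j → T (not (hasColourAt w j x))) (sym (≡ᵇ⇒≡ _ q (proj₁ (T-∧⁻ ci)))) t)
      (subst T (sym (hasColourAt-lookup w i x)) (≡⇒=ᶠ wi≡x))
    b⇒cross t i (suc j) ci = ⊥-elim (proj₂ (T-∧⁻ ci))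
    cross⇒b : CrossProper c w (x ∷ r) → T (not (hasColourAt w q x))
    cross⇒b cp = subst (λ b → T (not b)) (sym hasColourAt-last)
      (¬T⇒T-not (λ t → cp (fromℕ q) zero (T-∧⁺ (≡⇒≡ᵇ _ q (toℕ-fromℕ q)) _) (=ᶠ⇒≡ t)))

-- The recurrence

properCount : ∀ k N → (ℕ → ℕ → Bool) → List ℕ → ℕ
properCount k N f b = ∑ⱽ {k} N (λ κ → [ isProper N f κ ∧ (colourType κ =ᴸ b) ])

module LollipopRecurrence (k q n : ℕ) (b : List ℕ) where

  private
    m V : ℕ
    m = suc q
    V = m + suc n

    U L₊ L : ℕ
    U  = properCount k V (unionAdj m) b
    L₊ = properCount k V (lolliAdj (suc m)) b
    L  = properCount k V (lolliAdj m) b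

    ofType : ∀ {M} → Vec (Fin k) M → Bool
    ofType κ = colourType κ =ᴸ b

    good : Vec (Fin k) m → Vec (Fin k) (suc n) → Bool
    good w xr = (allDistinct w ∧ isProper (suc n) (lolliAdj 0) xr) ∧ ofType (w ++ⱽ xr)

    ∑∑ : (Vec (Fin k) m → Vec (Fin k) (suc n) → ℕ) → ℕ
    ∑∑ F = ∑ⱽ m (λ w → ∑ⱽ (suc n) (F w))

    ∑∑-+ : ∀ F G → ∑∑ (λ w xr → F w xr + G w xr) ≡ ∑∑ F + ∑∑ G
    ∑∑-+ F G = trans (∑ⱽ-cong m (λ w → ∑ⱽ-+ (suc n) (F w) (G w))) (∑ⱽ-+ m (λ w → ∑ⱽ (suc n) (F w)) (λ w → ∑ⱽ (suc n) (G w)))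

    newColour notAtLast : Vec (Fin k) m → Vec (Fin k) (suc n) → ℕ
    newColour w xr = [ good w xr ] * [ occurrences w (head xr) ≡ᵇ 0 ]
    notAtLast   w xr = [ good w xr ] * [ not (hasColourAt w q (head xr)) ]

    at : ℕ → Vec (Fin k) m → Vec (Fin k) (suc n) → ℕ
    at j w xr = [ good w xr ] * [ hasColourAt w j (head xr) ]

    S : ℕ → ℕ
    S j = ∑∑ (at j)

    U≡∑∑good : U ≡ ∑∑ (λ w xr → [ good w xr ])
    U≡∑∑good = trans (∑ⱽ-++ m (suc n) (λ κ → [ isProper V (unionAdj m) κ ∧ ofType κ ]))
      (∑ⱽ-cong m (λ w → ∑ⱽ-cong (suc n) (λ xr → cong (λ d → [ d ∧ ofType (w ++ⱽ xr) ]) (isProper-union w xr))))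

    attached : ∀ f (cond : Vec (Fin k) m → Fin k → Bool) →
      (∀ w x r → isProper V f (w ++ⱽ x ∷ r) ≡ (allDistinct w ∧ isProper (suc n) (lolliAdj 0) (x ∷ r)) ∧ cond w x) →
      properCount k V f b ≡ ∑∑ (λ w xr → [ good w xr ] * [ cond w (head xr) ])
    attached f cond isProper-f = trans (∑ⱽ-++ m (suc n) (λ κ → [ isProper V f κ ∧ ofType κ ]))
      (∑ⱽ-cong m (λ w → ∑ⱽ-cong (suc n) (pointwise w)))
      where
      pointwise : ∀ w xr → [ isProper V f (w ++ⱽ xr) ∧ ofType (w ++ⱽ xr) ] ≡ [ good w xr ] * [ cond w (head xr) ]
      pointwise w (x ∷ r) = begin
        [ isProper V f (w ++ⱽ x ∷ r) ∧ ofType (w ++ⱽ x ∷ r) ]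
          ≡⟨ cong (λ d → [ d ∧ ofType (w ++ⱽ x ∷ r) ]) (isProper-f w x r) ⟩
        [ ((allDistinct w ∧ isProper (suc n) (lolliAdj 0) (x ∷ r)) ∧ cond w x) ∧ ofType (w ++ⱽ x ∷ r) ]
          ≡⟨ [∧∧]≡[∧]*[] (allDistinct w ∧ isProper (suc n) (lolliAdj 0) (x ∷ r)) (cond w x) (ofType (w ++ⱽ x ∷ r)) ⟩
        [ good w (x ∷ r) ] * [ cond w x ] ∎

    ∑∑-∑< : ∀ (F : ℕ → Vec (Fin k) m → Vec (Fin k) (suc n) → ℕ) →
            ∑∑ (λ w xr → ∑< m (λ j → F j w xr)) ≡ ∑< m (λ j → ∑∑ (F j))
    ∑∑-∑< F = trans (∑ⱽ-cong m (λ w → ∑ⱽ-∑< (suc n) m (λ j → F j w))) (∑ⱽ-∑< m m (λ j w → ∑ⱽ (suc n) (F j w)))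

    L₊≡∑∑newColour : L₊ ≡ ∑∑ newColour
    L₊≡∑∑newColour = attached (lolliAdj (suc m)) (λ w x → occurrences w x ≡ᵇ 0) isProper-lollipop-suc

    L≡∑∑notAtLast : L ≡ ∑∑ notAtLast
    L≡∑∑notAtLast = attached (lolliAdj m) (λ w x → not (hasColourAt w q x)) isProper-lollipop

    good-split-by-clique : ∀ w xr → [ good w xr ] ≡ newColour w xr + ∑< m (λ j → at j w xr)
    good-split-by-clique w xr = begin
      [ good w xr ]
        ≡⟨ []≡[]*[≡ᵇ0]+[]* (good w xr) _ (λ t → allDistinct⇒occurrences≤1 w x (proj₁ (T-∧⁻ (proj₁ (T-∧⁻ t))))) ⟩
      [ good w xr ] * [ occurrences w x ≡ᵇ 0 ] + [ good w xr ] * occurrences w x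
        ≡⟨ cong (λ o → [ good w xr ] * [ occurrences w x ≡ᵇ 0 ] + [ good w xr ] * o) (occurrences≡∑<hasColourAt w x) ⟩
      [ good w xr ] * [ occurrences w x ≡ᵇ 0 ] + [ good w xr ] * ∑< m (λ j → [ hasColourAt w j x ])
        ≡⟨ cong ([ good w xr ] * [ occurrences w x ≡ᵇ 0 ] +_) (∑<-* m [ good w xr ] (λ j → [ hasColourAt w j x ])) ⟨
      [ good w xr ] * [ occurrences w x ≡ᵇ 0 ] + ∑< m (λ j → [ good w xr ] * [ hasColourAt w j x ]) ∎
      where
      x : Fin k
      x = head xr

    U≡L₊+∑<S : U ≡ L₊ + ∑< m S
    U≡L₊+∑<S = begin
      U ≡⟨ U≡∑∑good ⟩
      ∑∑ (λ w xr → [ good w xr ])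
        ≡⟨ ∑ⱽ-cong m (λ w → ∑ⱽ-cong (suc n) (good-split-by-clique w)) ⟩
      ∑∑ (λ w xr → newColour w xr + ∑< m (λ j → at j w xr))
        ≡⟨ ∑∑-+ newColour (λ w xr → ∑< m (λ j → at j w xr)) ⟩
      ∑∑ newColour + ∑∑ (λ w xr → ∑< m (λ j → at j w xr))
        ≡⟨ cong₂ _+_ (sym L₊≡∑∑newColour) (∑∑-∑< at) ⟩
      L₊ + ∑< m S ∎

    U≡L+S : U ≡ L + S q
    U≡L+S = begin
      U ≡⟨ U≡∑∑good ⟩
      ∑∑ (λ w xr → [ good w xr ])
        ≡⟨ ∑ⱽ-cong m (λ w → ∑ⱽ-cong (suc n) (λ xr → []≡[]*[not]+[]*[] (good w xr) (hasColourAt w q (head xr)))) ⟩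
      ∑∑ (λ w xr → notAtLast w xr + at q w xr)
        ≡⟨ ∑∑-+ notAtLast (at q) ⟩
      ∑∑ notAtLast + S q
        ≡⟨ cong (_+ S q) L≡∑∑notAtLast ⟨
      L + S q ∎

    good-swapAt : ∀ j w xr → good (swapAt j w) xr ≡ good w xr
    good-swapAt j w xr
      rewrite allDistinct-swapAt j w | colourType-++ (swapAt j w) xr | colourType-++ w xr | colourType-swapAt j w = refl

    S-step : ∀ j → j < q → S j ≡ S (suc j)
    S-step j j<q = trans (sym (∑ⱽ-swapAt m j (λ w → ∑ⱽ (suc n) (at j w))))
      (∑ⱽ-cong m (λ w → ∑ⱽ-cong (suc n) (λ xr →
        cong₂ (λ g h → [ g ] * [ h ]) (good-swapAt j w xr) (hasColourAt-swapAt j w (head xr) (s≤s j<q)))))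

    ∑<S : ∑< m S ≡ m * S q
    ∑<S = ∑<-const m S (S q) (λ j j<m → steps⇒≡ S S-step (≤⇒≤′ (s≤s⁻¹ j<m)))

  recurrence : properCount k (suc q + suc n) (lolliAdj (suc (suc q))) b + q * properCount k (suc q + suc n) (unionAdj (suc q)) b
               ≡ suc q * properCount k (suc q + suc n) (lolliAdj (suc q)) b
  recurrence = +-cancelʳ-≡ (m * S q) _ _ (begin
    L₊ + q * U + m * S q   ≡⟨ +-xy∙z≈xz∙y L₊ (q * U) (m * S q) ⟩
    L₊ + m * S q + q * U   ≡⟨ cong (λ s → L₊ + s + q * U) ∑<S ⟨
    L₊ + ∑< m S + q * U    ≡⟨ cong (_+ q * U) U≡L₊+∑<S ⟨
    U + q * U              ≡⟨⟩
    m * U                  ≡⟨ cong (m *_) U≡L+S ⟩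
    m * (L + S q)          ≡⟨ *-distribˡ-+ m L (S q) ⟩
    m * L + m * S q        ∎)

-- Products and the closed form

distinctCount : ∀ k m → List ℕ → ℕ
distinctCount k m b = ∑ⱽ {k} m (λ w → [ allDistinct w ∧ (colourType w =ᴸ b) ])

-- The coefficient of x^b in X_{K_m} X_{P_l}, counted with k colours.
cliquePathProduct : ∀ k m l → List ℕ → ℕ
cliquePathProduct k m l b =
  ∑ (λ b₁ → distinctCount k m b₁ * properCount k l (lolliAdj 0) (zipWith _∸_ b b₁)) (below b)

∑-upTo-[≡ᵇ]*[≡ᵇ∸] : ∀ t s y → ∑ (λ i → [ t ≡ᵇ i ] * [ s ≡ᵇ y ∸ i ]) (upTo (suc y)) ≡ [ t + s ≡ᵇ y ]
∑-upTo-[≡ᵇ]*[≡ᵇ∸] t s y = begin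
  ∑ (λ i → [ t ≡ᵇ i ] * [ s ≡ᵇ y ∸ i ]) (upTo (suc y)) ≡⟨ ∑-applyUpTo _ (λ i → i) (suc y) ⟩
  ∑< (suc y) (λ i → [ t ≡ᵇ i ] * [ s ≡ᵇ y ∸ i ])      ≡⟨ ∑<-select (suc y) t (λ i → [ s ≡ᵇ y ∸ i ]) ⟩
  [ t <ᵇ suc y ] * [ s ≡ᵇ y ∸ t ]                      ≡⟨ select-sum t s y ⟩
  [ t + s ≡ᵇ y ]                                        ∎
  where
  select-sum : ∀ t s y → [ t <ᵇ suc y ] * [ s ≡ᵇ y ∸ t ] ≡ [ t + s ≡ᵇ y ]
  select-sum zero    s y       = +-identityʳ _
  select-sum (suc t) s zero    = refl
  select-sum (suc t) s (suc y) = select-sum t s y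

-- A sum of two exponent vectors equals b for exactly one splitting b = b₁ + (b ∸ b₁) with b₁ ≤ b.
[zipWith+=ᴸ]≡∑below : ∀ b t s → length t ≡ length b → length s ≡ length b →
  [ zipWith _+_ t s =ᴸ b ] ≡ ∑ (λ b₁ → [ t =ᴸ b₁ ] * [ s =ᴸ zipWith _∸_ b b₁ ]) (below b)
[zipWith+=ᴸ]≡∑below []      []       []       _  _  = refl
[zipWith+=ᴸ]≡∑below []      (_ ∷ _)  _        () _
[zipWith+=ᴸ]≡∑below []      []       (_ ∷ _)  _  ()
[zipWith+=ᴸ]≡∑below (y ∷ b) []       _        () _
[zipWith+=ᴸ]≡∑below (y ∷ b) (_ ∷ _)  []       _  ()
[zipWith+=ᴸ]≡∑below (y ∷ b) (t₀ ∷ t) (s₀ ∷ s) e₁ e₂ = sym (begin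
  ∑ (λ b₁ → [ t₀ ∷ t =ᴸ b₁ ] * [ s₀ ∷ s =ᴸ zipWith _∸_ (y ∷ b) b₁ ]) (below (y ∷ b))
    ≡⟨ ∑-concatMap _ (λ i → map (i ∷_) (below b)) (upTo (suc y)) ⟩
  ∑ (λ i → ∑ (λ b₁ → [ t₀ ∷ t =ᴸ b₁ ] * [ s₀ ∷ s =ᴸ zipWith _∸_ (y ∷ b) b₁ ]) (map (i ∷_) (below b))) (upTo (suc y))
    ≡⟨ ∑-cong (upTo (suc y)) split-first ⟩
  ∑ (λ i → ([ t₀ ≡ᵇ i ] * [ s₀ ≡ᵇ y ∸ i ]) * ∑ (λ b₁ → [ t =ᴸ b₁ ] * [ s =ᴸ zipWith _∸_ b b₁ ]) (below b)) (upTo (suc y))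
    ≡⟨ ∑-cong (upTo (suc y)) (λ i → cong ([ t₀ ≡ᵇ i ] * [ s₀ ≡ᵇ y ∸ i ] *_)
         (sym ([zipWith+=ᴸ]≡∑below b t s (suc-injective e₁) (suc-injective e₂)))) ⟩
  ∑ (λ i → ([ t₀ ≡ᵇ i ] * [ s₀ ≡ᵇ y ∸ i ]) * [ zipWith _+_ t s =ᴸ b ]) (upTo (suc y))
    ≡⟨ ∑-*ʳ [ zipWith _+_ t s =ᴸ b ] (λ i → [ t₀ ≡ᵇ i ] * [ s₀ ≡ᵇ y ∸ i ]) (upTo (suc y)) ⟩
  ∑ (λ i → [ t₀ ≡ᵇ i ] * [ s₀ ≡ᵇ y ∸ i ]) (upTo (suc y)) * [ zipWith _+_ t s =ᴸ b ]
    ≡⟨ cong (_* [ zipWith _+_ t s =ᴸ b ]) (∑-upTo-[≡ᵇ]*[≡ᵇ∸] t₀ s₀ y) ⟩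
  [ t₀ + s₀ ≡ᵇ y ] * [ zipWith _+_ t s =ᴸ b ]
    ≡⟨ [∧] (t₀ + s₀ ≡ᵇ y) _ ⟨
  [ zipWith _+_ (t₀ ∷ t) (s₀ ∷ s) =ᴸ y ∷ b ] ∎)
  where
  split-first : ∀ i → ∑ (λ b₁ → [ t₀ ∷ t =ᴸ b₁ ] * [ s₀ ∷ s =ᴸ zipWith _∸_ (y ∷ b) b₁ ]) (map (i ∷_) (below b))
    ≡ ([ t₀ ≡ᵇ i ] * [ s₀ ≡ᵇ y ∸ i ]) * ∑ (λ b₁ → [ t =ᴸ b₁ ] * [ s =ᴸ zipWith _∸_ b b₁ ]) (below b)
  split-first i = begin
    ∑ (λ b₁ → [ t₀ ∷ t =ᴸ b₁ ] * [ s₀ ∷ s =ᴸ zipWith _∸_ (y ∷ b) b₁ ]) (map (i ∷_) (below b))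
      ≡⟨ ∑-map _ (i ∷_) (below b) ⟩
    ∑ (λ b₁ → [ (t₀ ≡ᵇ i) ∧ (t =ᴸ b₁) ] * [ (s₀ ≡ᵇ y ∸ i) ∧ (s =ᴸ zipWith _∸_ b b₁) ]) (below b)
      ≡⟨ ∑-cong (below b) (λ b₁ → [∧]*[∧] (t₀ ≡ᵇ i) (t =ᴸ b₁) (s₀ ≡ᵇ y ∸ i) (s =ᴸ zipWith _∸_ b b₁)) ⟩
    ∑ (λ b₁ → ([ t₀ ≡ᵇ i ] * [ s₀ ≡ᵇ y ∸ i ]) * ([ t =ᴸ b₁ ] * [ s =ᴸ zipWith _∸_ b b₁ ])) (below b)
      ≡⟨ ∑-* ([ t₀ ≡ᵇ i ] * [ s₀ ≡ᵇ y ∸ i ]) (λ b₁ → [ t =ᴸ b₁ ] * [ s =ᴸ zipWith _∸_ b b₁ ]) (below b) ⟩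
    ([ t₀ ≡ᵇ i ] * [ s₀ ≡ᵇ y ∸ i ]) * ∑ (λ b₁ → [ t =ᴸ b₁ ] * [ s =ᴸ zipWith _∸_ b b₁ ]) (below b) ∎

properCount-union : ∀ m l (b : List ℕ) →
                    properCount (length b) (m + l) (unionAdj m) b ≡ cliquePathProduct (length b) m l b
properCount-union m l b = begin
  ∑ⱽ (m + l) (λ κ → [ isProper (m + l) (unionAdj m) κ ∧ (colourType κ =ᴸ b) ])
    ≡⟨ ∑ⱽ-++ m l _ ⟩
  ∑ⱽ m (λ w → ∑ⱽ l (λ r → [ isProper (m + l) (unionAdj m) (w ++ⱽ r) ∧ (colourType (w ++ⱽ r) =ᴸ b) ]))
    ≡⟨ ∑ⱽ-cong m (λ w → ∑ⱽ-cong l (λ r → pointwise w r)) ⟩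
  ∑ⱽ m (λ w → ∑ⱽ l (λ r → ∑ (λ b₁ → F b₁ w r) (below b)))
    ≡⟨ ∑ⱽ-cong m (λ w → ∑ⱽ-∑ l (λ b₁ r → F b₁ w r) (below b)) ⟩
  ∑ⱽ m (λ w → ∑ (λ b₁ → ∑ⱽ l (F b₁ w)) (below b))
    ≡⟨ ∑ⱽ-∑ m (λ b₁ w → ∑ⱽ l (F b₁ w)) (below b) ⟩
  ∑ (λ b₁ → ∑ⱽ m (λ w → ∑ⱽ l (F b₁ w))) (below b)
    ≡⟨ ∑-cong (below b) (λ b₁ → ∑ⱽ-product m l _ _) ⟩
  cliquePathProduct k m l b ∎
  where
  k : ℕ
  k = length b
  F : List ℕ → Vec (Fin k) m → Vec (Fin k) l → ℕ
  F b₁ w r = [ allDistinct w ∧ (colourType w =ᴸ b₁) ] * [ isProper l (lolliAdj 0) r ∧ (colourType r =ᴸ zipWith _∸_ b b₁) ]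
  pointwise : ∀ w r → [ isProper (m + l) (unionAdj m) (w ++ⱽ r) ∧ (colourType (w ++ⱽ r) =ᴸ b) ] ≡ ∑ (λ b₁ → F b₁ w r) (below b)
  pointwise w r = begin
    [ isProper (m + l) (unionAdj m) (w ++ⱽ r) ∧ (colourType (w ++ⱽ r) =ᴸ b) ]
      ≡⟨ cong₂ (λ d t → [ d ∧ (t =ᴸ b) ]) (isProper-union w r) (colourType-++ w r) ⟩
    [ (allDistinct w ∧ isProper l (lolliAdj 0) r) ∧ (zipWith _+_ (colourType w) (colourType r) =ᴸ b) ]
      ≡⟨ [∧] (allDistinct w ∧ isProper l (lolliAdj 0) r) _ ⟩
    [ allDistinct w ∧ isProper l (lolliAdj 0) r ] * [ zipWith _+_ (colourType w) (colourType r) =ᴸ b ]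
      ≡⟨ cong₂ _*_ ([∧] (allDistinct w) _)
           ([zipWith+=ᴸ]≡∑below b (colourType w) (colourType r) (length-colourType w) (length-colourType r)) ⟩
    ([ allDistinct w ] * [ isProper l (lolliAdj 0) r ]) * ∑ (λ b₁ → [ colourType w =ᴸ b₁ ] * [ colourType r =ᴸ zipWith _∸_ b b₁ ]) (below b)
      ≡⟨ ∑-* ([ allDistinct w ] * [ isProper l (lolliAdj 0) r ]) _ (below b) ⟨
    ∑ (λ b₁ → ([ allDistinct w ] * [ isProper l (lolliAdj 0) r ]) * ([ colourType w =ᴸ b₁ ] * [ colourType r =ᴸ zipWith _∸_ b b₁ ])) (below b)
      ≡⟨ ∑-cong (below b) (λ b₁ → sym ([∧]*[∧] (allDistinct w) (colourType w =ᴸ b₁) (isProper l (lolliAdj 0) r) _)) ⟩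
    ∑ (λ b₁ → F b₁ w r) (below b) ∎

-- weight m i = (m-1)! (m-i-2) / (m-i-1)!, i.e. (m-1)! times the coefficient of the (i+1)-st summand.
weight : ℕ → ℕ → ℕ
weight m zero    = m ∸ 2
weight m (suc i) = (m ∸ 1) * weight (m ∸ 1) i

module CountingClosedForm (b : List ℕ) where

  private
    k : ℕ
    k = length b

  lollipopCount : ℕ → ℕ → ℕ
  lollipopCount m n = properCount k (m + n) (lolliAdj m) b

  pathCount : ℕ → ℕ
  pathCount N = properCount k N (lolliAdj 0) b

  lollipopCount-recurrence : ∀ q n →
    lollipopCount (suc (suc q)) n + q * cliquePathProduct k (suc q) (suc n) b ≡ suc q * lollipopCount (suc q) (suc n)
  lollipopCount-recurrence q n = begin
    lollipopCount (suc (suc q)) n + q * cliquePathProduct k (suc q) (suc n) b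
      ≡⟨ cong₂ (λ N U → properCount k N (lolliAdj (suc (suc q))) b + q * U)
           (sym (+-suc (suc q) n)) (sym (properCount-union (suc q) (suc n) b)) ⟩
    properCount k (suc q + suc n) (lolliAdj (suc (suc q))) b + q * properCount k (suc q + suc n) (unionAdj (suc q)) b
      ≡⟨ LollipopRecurrence.recurrence k q n b ⟩
    suc q * lollipopCount (suc q) (suc n) ∎

  lollipopCount-2 : ∀ n → lollipopCount 2 n ≡ pathCount (n + 2)
  lollipopCount-2 n = begin
    lollipopCount 2 n                      ≡⟨ +-identityʳ _ ⟨
    lollipopCount 2 n + 0                  ≡⟨ lollipopCount-recurrence 0 n ⟩
    lollipopCount 1 (suc n) + 0            ≡⟨ +-identityʳ _ ⟩
    properCount k (2 + n) (lolliAdj 1) b   ≡⟨ ∑ⱽ-cong {k} (2 + n) (λ κ → cong (λ d → [ d ∧ (colourType κ =ᴸ b) ])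
                                                (isProper-cong (2 + n) (lolliAdj 1) (lolliAdj 0) κ (λ u v → lolliAdj-1 (toℕ u) (toℕ v)))) ⟩
    pathCount (2 + n)                      ≡⟨ cong pathCount (+-comm 2 n) ⟩
    pathCount (n + 2)                      ∎

  lollipopCount-closed : ∀ p n →
    lollipopCount (suc (suc p)) n + ∑< p (λ i → weight (suc (suc p)) i * cliquePathProduct k (suc p ∸ i) (n + suc i) b)
      ≡ (suc p) ! * pathCount (n + suc (suc p))
  lollipopCount-closed zero    n = trans (+-identityʳ _) (trans (lollipopCount-2 n) (sym (+-identityʳ _)))
  lollipopCount-closed (suc p) n = begin
    lollipopCount m n + (suc p * KP m′ (n + 1) + ∑< p (λ i → (m′ * weight m′ i) * KP (suc p ∸ i) (n + suc (suc i))))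
      ≡⟨ cong₂ (λ u v → lollipopCount m n + (suc p * KP m′ u + v)) (+-comm n 1) (∑<-cong p (λ i →
           trans (*-assoc m′ (weight m′ i) _) (cong (λ z → m′ * (weight m′ i * KP (suc p ∸ i) z)) (+-suc n (suc i))))) ⟩
    lollipopCount m n + (suc p * KP m′ (suc n) + ∑< p (λ i → m′ * H i))
      ≡⟨ +-assoc (lollipopCount m n) _ _ ⟨
    lollipopCount m n + suc p * KP m′ (suc n) + ∑< p (λ i → m′ * H i)
      ≡⟨ cong₂ _+_ (lollipopCount-recurrence (suc p) n) (∑<-* p m′ H) ⟩
    m′ * lollipopCount m′ (suc n) + m′ * ∑< p H
      ≡⟨ *-distribˡ-+ m′ (lollipopCount m′ (suc n)) (∑< p H) ⟨
    m′ * (lollipopCount m′ (suc n) + ∑< p H)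
      ≡⟨ cong (m′ *_) (lollipopCount-closed p (suc n)) ⟩
    m′ * ((suc p) ! * pathCount (suc n + m′))
      ≡⟨ *-assoc m′ ((suc p) !) _ ⟨
    (suc (suc p)) ! * pathCount (suc n + m′)
      ≡⟨ cong (λ z → (suc (suc p)) ! * pathCount z) (+-suc n m′) ⟨
    (suc (suc p)) ! * pathCount (n + m) ∎
    where
    m′ m : ℕ
    m′ = suc (suc p)
    m  = suc m′
    KP : ℕ → ℕ → ℕ
    KP i l = cliquePathProduct k i l b
    H : ℕ → ℕ
    H i = weight m′ i * KP (suc p ∸ i) (suc n + suc i)

-- Rational coefficients

ι : ℕ → ℚ
ι n = pos n / 1

ι≡mkℚ : ∀ n → ι n ≡ mkℚ (pos n) 0 (coprime-sym (1-coprimeTo n))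
ι≡mkℚ n = ℚ.normalize-coprime (coprime-sym (1-coprimeTo n))

ι-+ : ∀ x y → ι x +ℚ ι y ≡ ι (x + y)
ι-+ x y rewrite ι≡mkℚ x | ι≡mkℚ y = cong (_/ 1) (cong₂ ℤ._+_ (ℤ.*-identityʳ (pos x)) (ℤ.*-identityʳ (pos y)))

ι-* : ∀ x y → ι x *ℚ ι y ≡ ι (x * y)
ι-* x y rewrite ι≡mkℚ x | ι≡mkℚ y = cong (_/ 1) (sym (ℤ.pos-* x y))

/-cross : ∀ x y d e → x * suc e ≡ y * suc d → pos x / suc d ≡ pos y / suc e
/-cross x y d e xe≡yd = ℚ.fromℚᵘ-cong {ℚᵘ.mkℚᵘ (pos x) d} {ℚᵘ.mkℚᵘ (pos y) e}
  (ℚᵘ.*≡* (trans (sym (ℤ.pos-* x (suc e))) (trans (cong pos xe≡yd) (ℤ.pos-* y (suc d)))))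

/-* : ∀ x y d e → (pos x / suc d) *ℚ (pos y / suc e) ≡ pos (x * y) / (suc d * suc e)
/-* x y d e = ℚ.toℚᵘ-injective (ℚᵘ.≃-trans (ℚ.toℚᵘ-homo-* (pos x / suc d) (pos y / suc e))
  (ℚᵘ.≃-trans (ℚᵘ.*-cong (ℚ.toℚᵘ-fromℚᵘ (ℚᵘ.mkℚᵘ (pos x) d)) (ℚ.toℚᵘ-fromℚᵘ (ℚᵘ.mkℚᵘ (pos y) e)))
  (ℚᵘ.≃-trans (ℚᵘ.≃-reflexive (cong (λ z → ℚᵘ.mkℚᵘ z (e + d * suc e)) (sym (ℤ.pos-* x y))))
    (ℚᵘ.≃-sym (ℚ.toℚᵘ-fromℚᵘ (ℚᵘ.mkℚᵘ (pos (x * y)) (e + d * suc e)))))))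

ι-*-over : ∀ x y q z → x * y ≡ z * q ! → ι x *ℚ (y over q !) ≡ ι z
ι-*-over x y q z xy≡zq! = begin
  ι x *ℚ (y over q !)            ≡⟨ cong (ι x *ℚ_) (ℚ./-cong {pos y} {q !} {pos y} {suc d} {{q !≢0}} refl q!≡1+d) ⟩
  ι x *ℚ (pos y / suc d)         ≡⟨ /-* x y 0 d ⟩
  pos (x * y) / suc (d + 0)      ≡⟨ /-cross (x * y) z (d + 0) 0 (begin
                                      x * y * 1         ≡⟨ *-identityʳ _ ⟩
                                      x * y             ≡⟨ xy≡zq! ⟩
                                      z * q !           ≡⟨ cong (λ e → z * e) q!≡1+d ⟩
                                      z * suc d         ≡⟨ cong (λ e → z * suc e) (+-identityʳ d) ⟨
                                      z * suc (d + 0)   ∎) ⟩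
  ι z                            ∎
  where
  d : ℕ
  d = pred (q !)
  q!≡1+d : q ! ≡ suc d
  q!≡1+d = sym (suc-pred (q !) {{q !≢0}})

ι-+-minus : ∀ x y → ι (x + y) -ℚ ι y ≡ ι x
ι-+-minus x y = begin
  ι (x + y) -ℚ ι y             ≡⟨ cong (_-ℚ ι y) (ι-+ x y) ⟨
  ι x +ℚ ι y -ℚ ι y            ≡⟨ ℚ.+-assoc (ι x) (ι y) (-ℚ ι y) ⟩
  ι x +ℚ (ι y -ℚ ι y)          ≡⟨ cong (ι x +ℚ_) (ℚ.+-inverseʳ (ι y)) ⟩
  ι x +ℚ 0ℚ                    ≡⟨ ℚ.+-identityʳ (ι x) ⟩
  ι x                          ∎

ι-*-minus : ∀ c p l s (y : ℚ) → l + s ≡ c * p → ι c *ℚ y ≡ ι s → ι c *ℚ (ι p -ℚ y) ≡ ι l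
ι-*-minus c p l s y l+s≡cp cy≡s = begin
  ι c *ℚ (ι p -ℚ y)                ≡⟨ ℚ.*-distribˡ-+ (ι c) (ι p) (-ℚ y) ⟩
  ι c *ℚ ι p +ℚ ι c *ℚ (-ℚ y)      ≡⟨ cong₂ _+ℚ_ (ι-* c p) (sym (ℚ.neg-distribʳ-* (ι c) y)) ⟩
  ι (c * p) -ℚ ι c *ℚ y            ≡⟨ cong₂ (λ u v → ι u -ℚ v) (sym l+s≡cp) cy≡s ⟩
  ι (l + s) -ℚ ι s                 ≡⟨ ι-+-minus l s ⟩
  ι l                              ∎

foldr-+ℚ-ι : ∀ (F : A → ℚ) (g : A → ℕ) {xs} → All (λ x → F x ≡ ι (g x)) xs → foldr _+ℚ_ 0ℚ (map F xs) ≡ ι (∑ g xs)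
foldr-+ℚ-ι F g []                    = refl
foldr-+ℚ-ι F g {x ∷ xs} (Fx≡ ∷ Fxs≡) = trans (cong₂ _+ℚ_ Fx≡ (foldr-+ℚ-ι F g Fxs≡)) (ι-+ (g x) (∑ g xs))

*-Σ[1…] : ∀ c (f : ℕ → PowerSeries) r a (g : ℕ → ℕ) →
          (∀ i → i < r → c *ℚ f (suc i) a ≡ ι (g i)) → c *ℚ (Σ[1… r ] f) a ≡ ι (∑< r g)
*-Σ[1…] c f r a g cf≡ = go (λ i → i) r g cf≡
  where
  go : ∀ h r g → (∀ i → i < r → c *ℚ f (suc (h i)) a ≡ ι (g i)) →
       c *ℚ foldr (λ i S → f (suc i) ⊕ S) zeroPS (applyUpTo h r) a ≡ ι (∑< r g)
  go h zero    g _   = ℚ.*-zeroʳ c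
  go h (suc r) g cf≡ = begin
    c *ℚ (f (suc (h 0)) a +ℚ foldr (λ i S → f (suc i) ⊕ S) zeroPS (applyUpTo (λ i → h (suc i)) r) a)
      ≡⟨ ℚ.*-distribˡ-+ c _ _ ⟩
    c *ℚ f (suc (h 0)) a +ℚ c *ℚ foldr (λ i S → f (suc i) ⊕ S) zeroPS (applyUpTo (λ i → h (suc i)) r) a
      ≡⟨ cong₂ _+ℚ_ (cf≡ 0 z<s) (go (λ i → h (suc i)) r (λ i → g (suc i)) (λ i i<r → cf≡ (suc i) (s<s i<r))) ⟩
    ι (g 0) +ℚ ι (∑< r (λ i → g (suc i)))
      ≡⟨ ι-+ (g 0) _ ⟩
    ι (∑< (suc r) g) ∎

X-graphOn : ∀ N f (a : List ℕ) → X (graphOn N f) a ≡ ι (properCount (length a) N f a)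
X-graphOn N f a = cong (λ z → pos z / 1) (trans (length-filterᵇ-maps (length a) N _)
  (∑ⱽ-cong N (λ κ → cong (λ t → [ isProper N f κ ∧ t ]) (hasType≡colourType a κ))))

X-K : ∀ j b₁ → X (K j) b₁ ≡ ι (distinctCount (length b₁) j b₁)
X-K j b₁ = trans (X-graphOn (j + 0) (lolliAdj j) b₁) (cong ι (begin
  properCount (length b₁) (j + 0) (lolliAdj j) b₁ ≡⟨ cong (λ N → properCount (length b₁) N (lolliAdj j) b₁) (+-identityʳ j) ⟩
  properCount (length b₁) j (lolliAdj j) b₁       ≡⟨ ∑ⱽ-cong j (λ w → cong (λ d → [ d ∧ (colourType w =ᴸ b₁) ]) (isProper-K j w)) ⟩
  distinctCount (length b₁) j b₁                  ∎))

length-below : ∀ a → All (λ b₁ → length b₁ ≡ length a) (below a)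
length-below []      = refl ∷ []
length-below (x ∷ a) =
  All.concat⁺ (All.map⁺ (All.universal (λ i → All.map⁺ (All.map (cong suc) (length-below a))) (upTo (suc x))))

X-K⊛X-P : ∀ j l a → (X (K j) ⊛ X (P l)) a ≡ ι (cliquePathProduct (length a) j l a)
X-K⊛X-P j l a = foldr-+ℚ-ι _ _ (All.map coefficient (length-below a))
  where
  coefficient : ∀ {b₁} → length b₁ ≡ length a →
    X (K j) b₁ *ℚ X (P l) (zipWith _∸_ a b₁) ≡ ι (distinctCount (length a) j b₁ * properCount (length a) l (lolliAdj 0) (zipWith _∸_ a b₁))
  coefficient {b₁} b₁∼a = begin
    X (K j) b₁ *ℚ X (P l) (zipWith _∸_ a b₁)
      ≡⟨ cong₂ _*ℚ_ (X-K j b₁) (X-graphOn l (lolliAdj 0) (zipWith _∸_ a b₁)) ⟩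
    ι (distinctCount (length b₁) j b₁) *ℚ ι (properCount (length (zipWith _∸_ a b₁)) l (lolliAdj 0) (zipWith _∸_ a b₁))
      ≡⟨ cong₂ (λ k k′ → ι (distinctCount k j b₁) *ℚ ι (properCount k′ l (lolliAdj 0) (zipWith _∸_ a b₁))) b₁∼a length-zipWith ⟩
    ι (distinctCount (length a) j b₁) *ℚ ι (properCount (length a) l (lolliAdj 0) (zipWith _∸_ a b₁))
      ≡⟨ ι-* (distinctCount (length a) j b₁) (properCount (length a) l (lolliAdj 0) (zipWith _∸_ a b₁)) ⟩
    ι (distinctCount (length a) j b₁ * properCount (length a) l (lolliAdj 0) (zipWith _∸_ a b₁)) ∎
    where
    length-zipWith : length (zipWith _∸_ a b₁) ≡ length a
    length-zipWith = trans (List.length-zipWith _∸_ a b₁) (trans (cong (length a ⊓_) b₁∼a) (⊓-idem (length a)))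

weight-spec : ∀ p i → i < p → (suc p) ! * (suc (suc p) ∸ suc i ∸ 1) ≡ weight (suc (suc p)) i * (suc (suc p) ∸ suc i) !
weight-spec p       zero    _         = *-comm ((suc p) !) p
weight-spec (suc p) (suc i) (s≤s i<p) = begin
  (suc (suc p)) ! * (suc p ∸ i ∸ 1)                     ≡⟨ *-assoc (suc (suc p)) ((suc p) !) _ ⟩
  suc (suc p) * ((suc p) ! * (suc p ∸ i ∸ 1))            ≡⟨ cong (suc (suc p) *_) (weight-spec p i i<p) ⟩
  suc (suc p) * (weight (suc (suc p)) i * (suc p ∸ i) !) ≡⟨ *-assoc (suc (suc p)) (weight (suc (suc p)) i) ((suc p ∸ i) !) ⟨
  weight (suc (suc (suc p))) (suc i) * (suc p ∸ i) !     ∎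

proposition3p4 : (m n : ℕ) → 2 ≤ m → (a : List ℕ) → X (Lollipop m n) a ≡ (fact (m ∸ 1) · (X (P (n + m)) ⊖ (Σ[1… m ∸ 2 ] (λ i → ((m ∸ i ∸ 1) over (m ∸ i) !) · (X (K (m ∸ i)) ⊛ X (P (n + i))))))) a
proposition3p4 (suc (suc p)) n (s≤s (s≤s z≤n)) a = begin
  X (Lollipop m n) a
    ≡⟨ X-graphOn (m + n) (lolliAdj m) a ⟩
  ι (lollipopCount m n)
    ≡⟨ ι-*-minus ((suc p) !) (pathCount (n + m)) (lollipopCount m n) (∑< p g) _
         (lollipopCount-closed p n) (*-Σ[1…] (fact (suc p)) f p a g summand) ⟨
  fact (suc p) *ℚ (ι (pathCount (n + m)) -ℚ (Σ[1… p ] f) a)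
    ≡⟨ cong (λ x → fact (suc p) *ℚ (x -ℚ (Σ[1… p ] f) a)) (X-graphOn (n + m) (lolliAdj 0) a) ⟨
  (fact (suc p) · (X (P (n + m)) ⊖ Σ[1… p ] f)) a ∎
  where
  open CountingClosedForm a
  m : ℕ
  m = suc (suc p)
  f : ℕ → PowerSeries
  f i = ((m ∸ i ∸ 1) over (m ∸ i) !) · (X (K (m ∸ i)) ⊛ X (P (n + i)))
  g : ℕ → ℕ
  g i = weight m i * cliquePathProduct (length a) (suc p ∸ i) (n + suc i) a
  summand : ∀ i → i < p → fact (suc p) *ℚ f (suc i) a ≡ ι (g i)
  summand i i<p = begin
    fact (suc p) *ℚ (c *ℚ (X (K (suc p ∸ i)) ⊛ X (P (n + suc i))) a)
      ≡⟨ ℚ.*-assoc (fact (suc p)) c _ ⟨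
    fact (suc p) *ℚ c *ℚ (X (K (suc p ∸ i)) ⊛ X (P (n + suc i))) a
      ≡⟨ cong₂ _*ℚ_ (ι-*-over ((suc p) !) _ (suc p ∸ i) (weight m i) (weight-spec p i i<p))
                    (X-K⊛X-P (suc p ∸ i) (n + suc i) a) ⟩
    ι (weight m i) *ℚ ι (cliquePathProduct (length a) (suc p ∸ i) (n + suc i) a)
      ≡⟨ ι-* (weight m i) _ ⟩
    ι (g i) ∎
    where
    c : ℚ
    c = (m ∸ suc i ∸ 1) over (m ∸ suc i) !
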